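{- Let $r,n$ be positive integers and $p,p',q,q'$ positive divisors of $r$ with $pq=p'q'$ dividing $rn$, and assume $\mathrm{GCD}(p,n)=\mathrm{GCD}(p',n)$ and $\mathrm{GCD}(q,n)=\mathrm{GCD}(q',n)$. For each prime $\pi$ let $a_\pi,a'_\pi,b'_\pi,c_\pi,d_\pi$ denote the multiplicities of $\pi$ in $p,p',q',r,n$ respectively. Let $x$ be an integer such that for every prime $\pi$ dividing $rn$: if $a_\pi=a'_\pi$ then $x\equiv 0\pmod{\pi^{a_\pi+1}}$; if $a_\pi>a'_\pi$ then $x\equiv \pi^{a'_\pi-d_\pi}\pmod{\pi^{a'_\pi-d_\pi+1}}$; if $a_\pi<a'_\pi$ then $\frac{rn}{pq}x+\frac{r}{q}\equiv\pi^{c_\pi-b'_\pi}\pmod{\pi^{c_\pi-b'_\pi+1}}$ (such an integer exists). Then the map $\varphi:G(r,p,n)\to G(r,p',q',n)$ sending $g$ to the image in $G(r,p',q',n)$ of $g\cdot c^{\frac{\Delta(g)}{p}x}$ (where $\Delta(g)$ is represented by any integer, necessarily a multiple of $p$) is a well-defined surjective group homomorphism whose kernel is $C_q=\langle c^{r/q}\rangle$. In particular it induces an isomorphism $G(r,p,q,n)\cong G(r,p',q',n)$.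
   Context: For a positive integer $r$ let $\zeta_r=\exp(2\pi\sqrt{ -1}/r)$ and $\mathbb{Z}_r=\mathbb{Z}/r\mathbb{Z}$. $G(r,n)$ is the group of $n\times n$ complex matrices with exactly one nonzero entry in each row and column, each nonzero entry an $r$th root of unity; its elements are written $(\pi,x)$ with $\pi\in S_n$, $x\in(\mathbb{Z}_r)^n$, meaning the matrix whose $i$th column has $\zeta_r^{x_i}$ in row $\pi(i)$. Put $\Delta(\pi,x)=\sum_i x_i\in\mathbb{Z}_r$. For $p\mid r$, $G(r,p,n)=\{g\in G(r,n):\Delta(g)\in p\mathbb{Z}_r\}$. Let $c=\zeta_rI_n$. When $p,q\mid r$ and $pq\mid rn$ the group $C_q=\langle c^{r/q}\rangle$ is central of order $q$ in $G(r,p,n)$ and $G(r,p,q,n):=G(r,p,n)/C_q$. The multiplicity of a prime $\pi$ in $k$ is the largest $e$ with $\pi^e\mid k$. -}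

module Defs where

open import Data.Nat as ℕ using (ℕ; NonZero; _^_)
open import Data.Nat.Divisibility using (_∣_)
open import Data.Integer as ℤ using (ℤ; +_; 0ℤ; _+_; _-_; _*_)
open import Data.Integer.Divisibility as ℤD using ()
open import Data.Fin using (Fin; zero; suc)
open import Data.Fin.Permutation using (Permutation′; _⟨$⟩ʳ_; _∘ₚ_; id)
open import Data.Product using (Σ; ∃; _×_; _,_)
open import Data.Nat.Properties using (m*n≢0)
open import Data.Nat.Primality using (Prime)
open import Relation.Binary.PropositionalEquality using (_≡_)
open import Relation.Nullary using (¬_)

infix 4 _≡_[mod_]
_≡_[mod_] : ℤ → ℤ → ℕ → Set
a ≡ b [mod m ] = (+ m) ℤD.∣ (a - b)

IsMultiplicity : ℕ → ℕ → ℕ → Set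
IsMultiplicity π k e = (π ^ e) ∣ k × ¬ ((π ^ ℕ.suc e) ∣ k)

-- Elements (π , x) of G(r,n): a permutation π of {1..n} and x ∈ (ℤ_r)^n,
-- with entries of x represented by integers (compared modulo r).
-- The matrix has ζ_r^{x_i} in row π(i) of column i.
record GElt (n : ℕ) : Set where
  constructor ⟪_,_⟫
  field
    perm : Permutation′ n
    vec  : Fin n → ℤ
open GElt public

ΣFin : ∀ {n} → (Fin n → ℤ) → ℤ
ΣFin {ℕ.zero}  f = 0ℤ
ΣFin {ℕ.suc n} f = f zero + ΣFin (λ i → f (suc i))

Δ : ∀ {n} → GElt n → ℤ
Δ g = ΣFin (vec g)

_·_ : ∀ {n} → GElt n → GElt n → GElt n
⟪ π , x ⟫ · ⟪ σ , y ⟫ = ⟪ σ ∘ₚ π , (λ i → x (σ ⟨$⟩ʳ i) + y i) ⟫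

e : ∀ {n} → GElt n
e = ⟪ id , (λ _ → 0ℤ) ⟫

-- c^m where c = ζ_r I_n.
cpow : ∀ {n} → ℤ → GElt n
cpow m = ⟪ id , (λ _ → m) ⟫

_≈[_]_ : ∀ {n} → GElt n → ℕ → GElt n → Set
g ≈[ r ] h = (∀ i → perm g ⟨$⟩ʳ i ≡ perm h ⟨$⟩ʳ i)
           × (∀ i → vec g i ≡ vec h i [mod r ])

InG : ∀ {n} → ℕ → ℕ → GElt n → Set
InG r p g = ∃ λ k → (+ p) * k ≡ Δ g [mod r ]

InC : ∀ {n} (r q : ℕ) .{{_ : NonZero q}} → GElt n → Set
InC r q g = ∃ λ m → g ≈[ r ] cpow (m * (+ (r ℕ./ q)))

_≈[_/C_]_ : ∀ {n} → GElt n → ℕ → (q : ℕ) .{{_ : NonZero q}} → GElt n → Set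
g ≈[ r /C q ] h = ∃ λ m → g ≈[ r ] (h · cpow (m * (+ (r ℕ./ q))))

-- The map φ: g ↦ g · c^{(Δ(g)/p) x}, where the integer D representing Δ(g)
-- is written D = p·k; k is any integer with p·k ≡ Δ(g) mod r.
φ : ∀ {n} → ℤ → GElt n → ℤ → GElt n
φ x g k = g · cpow (k * x)

Adm : ∀ {n} → ℕ → ℕ → GElt n → ℤ → Set
Adm r p g k = (+ p) * k ≡ Δ g [mod r ]

XCond : (r n p p' q q' : ℕ) .{{_ : NonZero p}} .{{_ : NonZero q}} → ℤ → Set
XCond r n p p' q q' x =
  ∀ π → Prime π → π ∣ (r ℕ.* n) →
  ∀ a a' b' c d →
  IsMultiplicity π p a → IsMultiplicity π p' a' → IsMultiplicity π q' b' →
  IsMultiplicity π r c → IsMultiplicity π n d →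
    (a ≡ a' → x ≡ 0ℤ [mod π ^ ℕ.suc a ])
  × (a' ℕ.< a → x ≡ + (π ^ (a' ℕ.∸ d)) [mod π ^ ℕ.suc (a' ℕ.∸ d) ])
  × (a ℕ.< a' →
       (+ ℕ._/_ (r ℕ.* n) (p ℕ.* q) {{m*n≢0 p q}}) * x + + (r ℕ./ q)
         ≡ + (π ^ (c ℕ.∸ b')) [mod π ^ ℕ.suc (c ℕ.∸ b') ])

module Submission where

-- Write u = p + n x.  If p k represents Δ(g) then Δ(g c^{kx}) = Δ(g) + n k x ≡ k u (mod r), so
-- well-definedness, the homomorphism property, surjectivity and the kernel of φ each reduce to a
-- divisibility A ∣ Z between integers built from p, u, r/q and r/q', with A ∣ r.  Such a
-- divisibility can be checked one prime π at a time on π-adic valuations.  The congruences imposed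
-- on x make v_π(u) = v_π(p') for every π; together with v_π(p) + v_π(q) = v_π(p') + v_π(q')
-- and the two gcd hypotheses (which force v_π(n) ≤ v_π(q), v_π(q') whenever v_π(p) ≠ v_π(p'))
-- this yields every local inequality.  Finally an x with the prescribed behaviour at each prime
-- exists by the Chinese remainder theorem.

open import Data.Nat.Base using (ℕ; NonZero)
import Data.Nat.Base as ℕ
import Data.Nat.Divisibility as ℕ
open import Data.Nat.GCD using (gcd)
open import Data.Integer.Base using (ℤ)
open import Relation.Binary.PropositionalEquality using (_≡_)

module Multiplicity where
  open import Data.Nat.Base
    using (ℕ; zero; suc; _+_; _*_; _^_; _≤_; _<_; _∸_; NonZero; s≤s; z≤n;
           ≢-nonZero; ≢-nonZero⁻¹; nonTrivial⇒n>1)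
  open import Relation.Binary.Definitions using (tri<; tri≈; tri>)
  open import Data.Nat.Properties
  open import Data.Nat.Divisibility
  open import Data.Nat.Induction using (<-rec)
  open import Data.Nat.Tactic.RingSolver using (solve-∀)
  open import Data.Nat.Primality
  open import Data.Nat.Primality.Factorisation using (factorise; module PrimeFactorisation)
  open import Data.Nat.ListAction using (product)
  open import Data.Nat.Coprimality using (Coprime; coprime-divisor)
  open import Data.Nat.GCD using (gcd; gcd-greatest; gcd[m,n]∣m; gcd[m,n]∣n; gcd[m,n]≢0)
  open import Data.List.Base using ([]; _∷_)
  open import Data.List.Relation.Unary.All using (All; []; _∷_)
  open import Data.Product using (∃; _×_; _,_; proj₁; proj₂)
  open import Data.Sum using (inj₁; inj₂)
  open import Data.Empty using (⊥-elim)
  open import Relation.Nullary using (¬_; yes; no)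
  open import Function using (_∘_)
  open import Relation.Binary.PropositionalEquality
  open import Defs using (IsMultiplicity)
  open PrimeFactorisation using (factors; isFactorisation; factorsPrime)

  private variable π σ X Y N B e f d : ℕ

  prime∣prime⇒≡ : Prime π → Prime σ → π ∣ σ → π ≡ σ
  prime∣prime⇒≡ pπ pσ π∣σ with prime⇒irreducible pσ π∣σ
  ... | inj₁ refl = ⊥-elim (¬prime[1] pπ)
  ... | inj₂ π≡σ  = π≡σ

  prime∣^⇒≡ : Prime π → Prime σ → ∀ e → π ∣ σ ^ e → π ≡ σ
  prime∣^⇒≡ pπ pσ zero π∣1 with ∣1⇒≡1 π∣1
  ... | refl = ⊥-elim (¬prime[1] pπ)
  prime∣^⇒≡ {σ = σ} pπ pσ (suc e) π∣σ^1+e with euclidsLemma σ (σ ^ e) pπ π∣σ^1+e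
  ... | inj₁ π∣σ  = prime∣prime⇒≡ pπ pσ π∣σ
  ... | inj₂ π∣σᵉ = prime∣^⇒≡ pπ pσ e π∣σᵉ

  ∃-prime∣ : ∀ X → .{{NonZero X}} → X ≢ 1 → ∃ λ σ → Prime σ × σ ∣ X
  ∃-prime∣ X X≢1 with factors (factorise X) | isFactorisation (factorise X) | factorsPrime (factorise X)
  ... | []     | X≡1   | _      = ⊥-elim (X≢1 X≡1)
  ... | σ ∷ σs | X≡σ*Π | pσ ∷ _ = σ , pσ , subst (σ ∣_) (sym X≡σ*Π) (m∣m*n (product σs))

  ^-monoʳ-∣ : ∀ π → e ≤ f → π ^ e ∣ π ^ f
  ^-monoʳ-∣ {e} {f} π e≤f = subst (π ^ e ∣_) π^[f∸e+e]≡π^f (n∣m*n (π ^ (f ∸ e)))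
    where
    π^[f∸e+e]≡π^f : π ^ (f ∸ e) * π ^ e ≡ π ^ f
    π^[f∸e+e]≡π^f = trans (sym (^-distribˡ-+-* π (f ∸ e) e)) (cong (π ^_) (m∸n+n≡m e≤f))

  n<π^n : Prime π → ∀ e → e < π ^ e
  n<π^n pπ zero = s≤s z≤n
  n<π^n {π} pπ (suc e) = begin-strict
    suc e            <⟨ s≤s (n<π^n pπ e) ⟩
    suc (π ^ e)      ≤⟨ +-monoʳ-≤ 1 (m≤m+n (π ^ e) 0) ⟩
    1 + (π ^ e + 0)  ≤⟨ +-monoˡ-≤ (π ^ e + 0) (m^n>0 π e) ⟩
    2 * π ^ e        ≤⟨ *-monoˡ-≤ (π ^ e) (nonTrivial⇒n>1 π) ⟩
    π * π ^ e        ∎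
    where
    open ≤-Reasoning
    instance _ = prime⇒nonZero pπ
    instance _ = prime⇒nonTrivial pπ

  ¬∣⇒coprime-^ : Prime π → ¬ π ∣ Y → ∀ e → Coprime (π ^ e) Y
  ¬∣⇒coprime-^ {π} {Y} pπ π∤Y e {i} (i∣πᵉ , i∣Y) with i ≟ 1
  ... | yes i≡1 = i≡1
  ... | no  i≢1 = ⊥-elim (π∤Y (subst (_∣ Y) ρ≡π (∣-trans ρ∣i i∣Y)))
    where
    i≢0 : i ≢ 0
    i≢0 refl = ≢-nonZero⁻¹ (π ^ e) {{m^n≢0 π e {{prime⇒nonZero pπ}}}} (0∣⇒≡0 i∣πᵉ)
    ρ-prime-factor = ∃-prime∣ i {{≢-nonZero i≢0}} i≢1
    ρ∣i = proj₂ (proj₂ ρ-prime-factor)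
    ρ≡π = prime∣^⇒≡ (proj₁ (proj₂ ρ-prime-factor)) pπ e (∣-trans ρ∣i i∣πᵉ)

  prime-powers∣⇒∣ : ∀ A → .{{NonZero A}} → (∀ σ e → Prime σ → σ ^ e ∣ A → σ ^ e ∣ B) → A ∣ B
  prime-powers∣⇒∣ {B} A local =
    subst (_∣ B) (sym A≡Π)
      (product∣ (factors F) (factorsPrime F) (λ σ e pσ → local σ e pσ ∘ subst (σ ^ e ∣_) (sym A≡Π)))
    where
    F = factorise A
    A≡Π = isFactorisation F
    product∣ : ∀ {B} σs → All Prime σs →
               (∀ σ e → Prime σ → σ ^ e ∣ product σs → σ ^ e ∣ B) → product σs ∣ B
    product∣ {B} [] _ _ = 1∣ B
    product∣ {B} (π ∷ σs) (pπ ∷ pσs) local =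
      subst (π * product σs ∣_) (sym B≡πB′) (*-monoʳ-∣ π (product∣ σs pσs local′))
      where
      instance _ = prime⇒nonZero pπ
      π∣B : π ∣ B
      π∣B = subst (_∣ B) (*-identityʳ π)
              (local π 1 pπ (∣-trans (∣-reflexive (*-identityʳ π)) (m∣m*n (product σs))))
      B′ = quotient π∣B
      B≡πB′ : B ≡ π * B′
      B≡πB′ = m∣n⇒n≡m*quotient π∣B
      local′ : ∀ σ e → Prime σ → σ ^ e ∣ product σs → σ ^ e ∣ B′
      local′ σ e pσ σᵉ∣Π with σ ≟ π
      ... | yes refl = *-cancelˡ-∣ σ (subst (σ ^ suc e ∣_) B≡πB′ (local σ (suc e) pσ (*-monoʳ-∣ σ σᵉ∣Π)))
      ... | no  σ≢π  = coprime-divisor (¬∣⇒coprime-^ pσ (σ≢π ∘ prime∣prime⇒≡ pσ pπ) e)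
                         (subst (σ ^ e ∣_) B≡πB′ (local σ e pσ (∣-trans σᵉ∣Π (n∣m*n π))))

  multiplicity-maximal : IsMultiplicity π X e → π ^ f ∣ X → f ≤ e
  multiplicity-maximal {π} {e = e} {f = f} (_ , π^1+e∤X) π^f∣X with f ≤? e
  ... | yes f≤e = f≤e
  ... | no  f≰e = ⊥-elim (π^1+e∤X (∣-trans (^-monoʳ-∣ π (≰⇒> f≰e)) π^f∣X))

  multiplicity-unique : IsMultiplicity π X e → IsMultiplicity π X f → e ≡ f
  multiplicity-unique {π} mₑ m_f =
    ≤-antisym (multiplicity-maximal {π} m_f (proj₁ mₑ)) (multiplicity-maximal {π} mₑ (proj₁ m_f))

  multiplicity⇒nonZero : IsMultiplicity π X e → NonZero X
  multiplicity⇒nonZero {X = zero}  (_ , π^1+e∤0) = ⊥-elim (π^1+e∤0 (_ ∣0))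
  multiplicity⇒nonZero {X = suc _} _ = _

  multiplicity-< : Prime π → IsMultiplicity π X e → e < X
  multiplicity-< {π} {e = e} pπ m = <-≤-trans (n<π^n pπ e) (∣⇒≤ {{multiplicity⇒nonZero {π} {e = e} m}} (proj₁ m))

  multiplicity-exists : Prime π → ∀ X → .{{NonZero X}} → ∃ (IsMultiplicity π X)
  multiplicity-exists {π} pπ = <-rec (λ X → .{{NonZero X}} → ∃ (IsMultiplicity π X)) step
    where
    instance
      _ = prime⇒nonZero pπ
      _ = prime⇒nonTrivial pπ
    step : ∀ X → (∀ {Y} → Y < X → .{{NonZero Y}} → ∃ (IsMultiplicity π Y)) →
           .{{NonZero X}} → ∃ (IsMultiplicity π X)
    step X rec with π ∣? X
    ... | no  π∤X = 0 , 1∣ X , π∤X ∘ subst (_∣ X) (*-identityʳ π)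
    ... | yes π∣X with rec (quotient-< π∣X) {{quotient≢0 π∣X}}
    ...   | e , π^e∣X/π , π^1+e∤X/π =
      suc e , subst (π ^ suc e ∣_) (sym X≡π*X/π) (*-monoʳ-∣ π π^e∣X/π)
            , π^1+e∤X/π ∘ *-cancelˡ-∣ π ∘ subst (π ^ suc (suc e) ∣_) X≡π*X/π
      where X≡π*X/π = m∣n⇒n≡m*quotient π∣X

  multiplicity-^ : Prime π → ∀ e → IsMultiplicity π (π ^ e) e
  multiplicity-^ {π} pπ e = ∣-refl , λ π^1+e∣π^e → ¬prime[1] (subst Prime (π∣1 π^1+e∣π^e) pπ)
    where
    instance _ = m^n≢0 π e {{prime⇒nonZero pπ}}
    π∣1 : π ^ suc e ∣ π ^ e → π ≡ 1
    π∣1 = ∣1⇒≡1 ∘ *-cancelʳ-∣ (π ^ e) ∘ subst (π * π ^ e ∣_) (sym (*-identityˡ (π ^ e)))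

  multiplicity⇒cofactor : IsMultiplicity π X e → ∃ λ X₀ → X ≡ π ^ e * X₀ × ¬ π ∣ X₀
  multiplicity⇒cofactor {π} {e = e} (π^e∣X , π^1+e∤X) = X₀ , X≡π^e*X₀ , π∤X₀
    where
    X₀ = quotient π^e∣X
    X≡π^e*X₀ = m∣n⇒n≡m*quotient π^e∣X
    π∤X₀ : ¬ π ∣ X₀
    π∤X₀ π∣X₀ = π^1+e∤X (subst (π ^ suc e ∣_) (sym X≡π^e*X₀)
                  (subst (_∣ π ^ e * X₀) (*-comm (π ^ e) π) (*-monoʳ-∣ (π ^ e) π∣X₀)))

  multiplicity-* : Prime π → IsMultiplicity π X e → IsMultiplicity π Y f → IsMultiplicity π (X * Y) (e + f)
  multiplicity-* {π} {e = e} {f = f} pπ mX mY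
    with multiplicity⇒cofactor {π = π} {e = e} mX | multiplicity⇒cofactor {π = π} {e = f} mY
  ... | X₀ , refl , π∤X₀ | Y₀ , refl , π∤Y₀ =
    subst (_∣ π ^ e * X₀ * (π ^ f * Y₀)) (sym (^-distribˡ-+-* π e f)) (*-pres-∣ (proj₁ mX) (proj₁ mY)) , π^1+e+f∤
    where
    instance _ = m^n≢0 π (e + f) {{prime⇒nonZero pπ}}
    regroup : ∀ a b c d → a * c * (b * d) ≡ a * b * (c * d)
    regroup = solve-∀
    XY≡ : π ^ e * X₀ * (π ^ f * Y₀) ≡ π ^ (e + f) * (X₀ * Y₀)
    XY≡ = trans (regroup (π ^ e) (π ^ f) X₀ Y₀) (cong (_* (X₀ * Y₀)) (sym (^-distribˡ-+-* π e f)))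
    π^1+e+f∤ : ¬ π ^ suc (e + f) ∣ π ^ e * X₀ * (π ^ f * Y₀)
    π^1+e+f∤ d
      with euclidsLemma X₀ Y₀ pπ (*-cancelˡ-∣ (π ^ (e + f)) (subst₂ _∣_ (*-comm π (π ^ (e + f))) XY≡ d))
    ... | inj₁ π∣X₀ = π∤X₀ π∣X₀
    ... | inj₂ π∣Y₀ = π∤Y₀ π∣Y₀

  multiplicity-*-cancelʳ : Prime π → IsMultiplicity π (X * Y) (e + f) → IsMultiplicity π Y f → IsMultiplicity π X e
  multiplicity-*-cancelʳ {π} {X} {e = e} {f = f} pπ mXY mY
    with multiplicity-exists pπ X {{m*n≢0⇒m≢0 X {{multiplicity⇒nonZero {π} {e = e + f} mXY}}}}
  ... | g , mX = subst (IsMultiplicity π X) (sym (+-cancelʳ-≡ f e g e+f≡g+f)) mX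
    where e+f≡g+f = multiplicity-unique {π} mXY (multiplicity-* {e = g} {f = f} pπ mX mY)

  ^∣*-cancelʳ : Prime π → IsMultiplicity π Y f → π ^ (e + f) ∣ X * Y → π ^ e ∣ X
  ^∣*-cancelʳ {π} {f = f} {e = e} {X = X} pπ mY π^[e+f]∣XY with multiplicity⇒cofactor {π = π} {e = f} mY
  ... | Y₀ , refl , π∤Y₀ =
    coprime-divisor (¬∣⇒coprime-^ pπ π∤Y₀ e) (*-cancelˡ-∣ (π ^ f) (subst₂ _∣_ π^[e+f]≡ XY≡ π^[e+f]∣XY))
    where
    instance _ = m^n≢0 π f {{prime⇒nonZero pπ}}
    π^[e+f]≡ : π ^ (e + f) ≡ π ^ f * π ^ e
    π^[e+f]≡ = trans (^-distribˡ-+-* π e f) (*-comm (π ^ e) (π ^ f))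
    swap : ∀ a b c → a * (b * c) ≡ b * (c * a)
    swap = solve-∀
    XY≡ : X * (π ^ f * Y₀) ≡ π ^ f * (Y₀ * X)
    XY≡ = swap X (π ^ f) Y₀

  private
    gcd≡⇒multiplicity≤-< : IsMultiplicity π X e → IsMultiplicity π Y f → IsMultiplicity π N d →
                           gcd X N ≡ gcd Y N → e < f → d ≤ e
    gcd≡⇒multiplicity≤-< {π} {X} {e} {N = N} {d} (_ , π^1+e∤X) (π^f∣Y , _) (π^d∣N , _) g≡g′ e<f with d ≤? e
    ... | yes d≤e = d≤e
    ... | no  d≰e = ⊥-elim (π^1+e∤X (∣-trans (subst (π ^ suc e ∣_) (sym g≡g′) π^1+e∣gcd) (gcd[m,n]∣m X N)))
      where
      π^1+e∣gcd = gcd-greatest (∣-trans (^-monoʳ-∣ π e<f) π^f∣Y) (∣-trans (^-monoʳ-∣ π (≰⇒> d≰e)) π^d∣N)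

  gcd≡⇒multiplicity≤ : IsMultiplicity π X e → IsMultiplicity π Y f → IsMultiplicity π N d →
                       gcd X N ≡ gcd Y N → e ≢ f → d ≤ e
  gcd≡⇒multiplicity≤ {e = e} {f = f} mX mY mN g≡g′ e≢f with <-cmp e f
  ... | tri< e<f _ _ = gcd≡⇒multiplicity≤-< mX mY mN g≡g′ e<f
  ... | tri≈ _ e≡f _ = ⊥-elim (e≢f e≡f)
  ... | tri> _ _ f<e = ≤-trans (gcd≡⇒multiplicity≤-< mY mX mN (sym g≡g′) f<e) (<⇒≤ f<e)

  gcd[X,π^m]∣π^e : Prime π → IsMultiplicity π X e → ∀ m → gcd X (π ^ m) ∣ π ^ e
  gcd[X,π^m]∣π^e {π} {X} {e} pπ mX m = prime-powers∣⇒∣ (gcd X (π ^ m)) {{≢-nonZero gcd≢0}} local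
    where
    gcd≢0 = gcd[m,n]≢0 X (π ^ m) (inj₂ (≢-nonZero⁻¹ (π ^ m) {{m^n≢0 π m {{prime⇒nonZero pπ}}}}))
    local : ∀ σ f → Prime σ → σ ^ f ∣ gcd X (π ^ m) → σ ^ f ∣ π ^ e
    local σ zero    _  _ = 1∣ (π ^ e)
    local σ (suc f) pσ σ^1+f∣g
      with prime∣^⇒≡ pσ pπ m (∣-trans (m∣m*n (σ ^ f)) (∣-trans σ^1+f∣g (gcd[m,n]∣n X (π ^ m))))
    ... | refl = ^-monoʳ-∣ {suc f} {e} σ
                   (multiplicity-maximal {σ} {f = suc f} mX (∣-trans σ^1+f∣g (gcd[m,n]∣m X (π ^ m))))

module IntegerValuation where
  open import Data.Nat.Base using (suc; _^_; _≤_)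
  import Data.Nat.Properties as ℕ
  open import Data.Nat.Divisibility using (_∣_; ∣-trans; *-pres-∣; ∣m⇒∣m*n; ∣n⇒∣m*n)
  open import Data.Nat.Primality using (Prime)
  open import Data.Integer.Base using (+_; ∣_∣; _+_; _-_; _*_)
  open import Data.Integer.Properties using (abs-*; *-comm)
  import Data.Integer.Divisibility.Signed as Signed
  open import Data.Integer.Tactic.RingSolver using (solve-∀)
  open import Data.Product using (_,_; proj₁)
  open import Relation.Binary.PropositionalEquality
  open import Defs using (IsMultiplicity; _≡_[mod_])
  open Multiplicity

  -- π ^ e divides X, i.e. v_π(X) ≥ e; a record so that π and e can be recovered by unification.
  infix 4 v[_]_≥_
  record v[_]_≥_ (π : ℕ) (X : ℤ) (e : ℕ) : Set where
    constructor from-∣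
    field to-∣ : π ^ e ∣ ∣ X ∣
  open v[_]_≥_ public

  private variable
    π e f : ℕ
    X Y : ℤ

  toSigned : v[ π ] X ≥ e → + (π ^ e) Signed.∣ X
  toSigned (from-∣ π^e∣X) = Signed.∣ᵤ⇒∣ π^e∣X

  fromSigned : + (π ^ e) Signed.∣ X → v[ π ] X ≥ e
  fromSigned π^e∣X = from-∣ (Signed.∣⇒∣ᵤ π^e∣X)

  ≡[mod]⇒≥ : X ≡ Y [mod π ^ e ] → v[ π ] (X - Y) ≥ e
  ≡[mod]⇒≥ = from-∣

  multiplicity⇒≥ : IsMultiplicity π ∣ X ∣ e → v[ π ] X ≥ e
  multiplicity⇒≥ m = from-∣ (proj₁ m)

  ≥-weaken : f ≤ e → v[ π ] X ≥ e → v[ π ] X ≥ f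
  ≥-weaken {π = π} f≤e (from-∣ π^e∣X) = from-∣ (∣-trans (^-monoʳ-∣ π f≤e) π^e∣X)

  ≥-+ : v[ π ] X ≥ e → v[ π ] Y ≥ e → v[ π ] (X + Y) ≥ e
  ≥-+ vX vY = fromSigned (Signed.∣m∣n⇒∣m+n (toSigned vX) (toSigned vY))

  ≥-sub : v[ π ] X ≥ e → v[ π ] Y ≥ e → v[ π ] (X - Y) ≥ e
  ≥-sub vX vY = fromSigned (Signed.∣m∣n⇒∣m-n (toSigned vX) (toSigned vY))

  ≥-*ˡ : ∀ X → v[ π ] Y ≥ e → v[ π ] (X * Y) ≥ e
  ≥-*ˡ {π} {Y} {e} X (from-∣ π^e∣Y) = from-∣ (subst (π ^ e ∣_) (sym (abs-* X Y)) (∣n⇒∣m*n ∣ X ∣ π^e∣Y))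

  ≥-*ʳ : ∀ Y → v[ π ] X ≥ e → v[ π ] (X * Y) ≥ e
  ≥-*ʳ {π} {X} {e} Y (from-∣ π^e∣X) = from-∣ (subst (π ^ e ∣_) (sym (abs-* X Y)) (∣m⇒∣m*n ∣ Y ∣ π^e∣X))

  ≥-* : v[ π ] X ≥ e → v[ π ] Y ≥ f → v[ π ] (X * Y) ≥ e ℕ.+ f
  ≥-* {π} {X} {e} {Y} {f} (from-∣ π^e∣X) (from-∣ π^f∣Y) =
    from-∣ (subst₂ _∣_ (sym (ℕ.^-distribˡ-+-* π e f)) (sym (abs-* X Y)) (*-pres-∣ π^e∣X π^f∣Y))

  ≥-cancelʳ : Prime π → IsMultiplicity π ∣ Y ∣ f → v[ π ] (X * Y) ≥ e ℕ.+ f → v[ π ] X ≥ e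
  ≥-cancelʳ {π} {Y} {f} {X} {e} pπ mY (from-∣ π^[e+f]∣XY) =
    from-∣ (^∣*-cancelʳ {π} {f = f} {e = e} pπ mY (subst (π ^ (e ℕ.+ f) ∣_) (abs-* X Y) π^[e+f]∣XY))

  ≥-cancelˡ : Prime π → IsMultiplicity π ∣ Y ∣ f → v[ π ] (Y * X) ≥ f ℕ.+ e → v[ π ] X ≥ e
  ≥-cancelˡ {π} {Y} {f} {X} {e} pπ mY vYX =
    ≥-cancelʳ {X = X} {e} pπ mY (subst₂ (λ Z k → v[ π ] Z ≥ k) (*-comm Y X) (ℕ.+-comm f e) vYX)

  multiplicity-+ : IsMultiplicity π ∣ X ∣ e → v[ π ] Y ≥ suc e → IsMultiplicity π ∣ X + Y ∣ e
  multiplicity-+ {π} {X} {e} {Y} (π^e∣X , π^1+e∤X) vY =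
      to-∣ (≥-+ {X = X} (from-∣ π^e∣X) (≥-weaken (ℕ.n≤1+n e) vY))
    , λ π^1+e∣X+Y → π^1+e∤X (to-∣ (subst (λ Z → v[ π ] Z ≥ suc e) (X+Y-Y≡X X Y)
                                    (≥-sub {X = X + Y} (from-∣ π^1+e∣X+Y) vY)))
    where
    X+Y-Y≡X : ∀ X Y → X + Y - Y ≡ X
    X+Y-Y≡X = solve-∀

  multiplicityℤ-* : Prime π → IsMultiplicity π ∣ X ∣ e → IsMultiplicity π ∣ Y ∣ f →
                    IsMultiplicity π ∣ X * Y ∣ (e ℕ.+ f)
  multiplicityℤ-* {π} {X} {e} {Y} {f} pπ mX mY =
    subst (λ Z → IsMultiplicity π Z (e ℕ.+ f)) (sym (abs-* X Y)) (multiplicity-* {e = e} {f = f} pπ mX mY)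

  multiplicityℤ-*-cancelʳ : Prime π → IsMultiplicity π ∣ X * Y ∣ (e ℕ.+ f) → IsMultiplicity π ∣ Y ∣ f →
                            IsMultiplicity π ∣ X ∣ e
  multiplicityℤ-*-cancelʳ {π} {X} {Y} {e} {f} pπ mXY =
    multiplicity-*-cancelʳ {e = e} pπ (subst (λ Z → IsMultiplicity π Z (e ℕ.+ f)) (abs-* X Y) mXY)

  ≡π^e⇒multiplicity : Prime π → X ≡ + (π ^ e) [mod π ^ suc e ] → IsMultiplicity π ∣ X ∣ e
  ≡π^e⇒multiplicity {π} {X} {e} pπ X≡π^e =
    subst (λ Z → IsMultiplicity π ∣ Z ∣ e) (π^e+[X-π^e]≡X (+ (π ^ e)) X)
      (multiplicity-+ {π} {+ (π ^ e)} {e} {X - + (π ^ e)} (multiplicity-^ pπ e)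
                      (≡[mod]⇒≥ {X = X} {Y = + (π ^ e)} X≡π^e))
    where
    π^e+[X-π^e]≡X : ∀ P X → P + (X - P) ≡ X
    π^e+[X-π^e]≡X = solve-∀

module LinearCongruence where
  open import Data.Nat.Base as ℕ using (ℕ)
  import Data.Nat.Properties as ℕ
  import Data.Nat.Divisibility as ℕ
  open import Data.Nat.GCD using (gcd; gcd-GCD; module Bézout)
  open import Data.Integer.Base using (ℤ; +_; -_; ∣_∣; _+_; _-_; _*_)
  open import Data.Integer.Properties using (pos-*; neg-distribˡ-*; neg-distribʳ-*; +∣i∣≡i⊎+∣i∣≡-i)
  open import Data.Integer.Divisibility.Signed using (_∣_; divides; ∣ᵤ⇒∣; ∣n⇒∣m*n)
  open import Data.Integer.Tactic.RingSolver using (solve-∀)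
  open import Data.Product using (∃; _,_)
  open import Data.Sum using (inj₁; inj₂)
  open import Relation.Binary.PropositionalEquality
  open ≡-Reasoning

  bézout-mod : ∀ A M → ∃ λ t → + M ∣ + A * t - + gcd A M
  bézout-mod A M with Bézout.identity (gcd-GCD A M)
  ... | Bézout.+- x y g+yM≡xA = + x , divides (+ y) (begin
    + A * + x - + g          ≡⟨ cong (_- + g) lift ⟨
    + g + + y * + M - + g    ≡⟨ cancel (+ g) (+ y * + M) ⟩
    + y * + M                ∎)
    where
    g = gcd A M
    lift : + g + + y * + M ≡ + A * + x
    lift = begin
      + g + + y * + M  ≡⟨ cong (λ z → + g + z) (pos-* y M) ⟨
      + (g ℕ.+ y ℕ.* M) ≡⟨ cong +_ (trans g+yM≡xA (ℕ.*-comm x A)) ⟩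
      + (A ℕ.* x)       ≡⟨ pos-* A x ⟩
      + A * + x         ∎
    cancel : ∀ a b → a + b - a ≡ b
    cancel = solve-∀
  ... | Bézout.-+ x y g+xA≡yM = - + x , divides (- + y) (begin
    + A * - + x - + g        ≡⟨ rearrange (+ A) (+ x) (+ g) ⟩
    - (+ g + + A * + x)      ≡⟨ cong -_ lift ⟩
    - (+ y * + M)            ≡⟨ neg-distribˡ-* (+ y) (+ M) ⟩
    - + y * + M              ∎)
    where
    g = gcd A M
    lift : + g + + A * + x ≡ + y * + M
    lift = begin
      + g + + A * + x   ≡⟨ cong (λ z → + g + z) (pos-* A x) ⟨
      + (g ℕ.+ A ℕ.* x) ≡⟨ cong (λ z → + (g ℕ.+ z)) (ℕ.*-comm A x) ⟩
      + (g ℕ.+ x ℕ.* A) ≡⟨ cong +_ g+xA≡yM ⟩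
      + (y ℕ.* M)       ≡⟨ pos-* y M ⟩
      + y * + M         ∎
    rearrange : ∀ a x g → a * - x - g ≡ - (g + a * x)
    rearrange = solve-∀

  private
    solvable⁺ : ∀ A M B → gcd A M ℕ.∣ ∣ B ∣ → ∃ λ t → + M ∣ + A * t - B
    solvable⁺ A M B g∣B with bézout-mod A M | ∣ᵤ⇒∣ {+ gcd A M} {B} g∣B
    ... | t , M∣At-g | divides β refl =
      t * β , subst (+ M ∣_) (distrib (+ A) t β (+ gcd A M)) (∣n⇒∣m*n β M∣At-g)
      where
      distrib : ∀ a t β g → β * (a * t - g) ≡ a * (t * β) - β * g
      distrib = solve-∀

  solvable : ∀ (A : ℤ) M B → gcd ∣ A ∣ M ℕ.∣ ∣ B ∣ → ∃ λ t → + M ∣ A * t - B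
  solvable A M B g∣B with solvable⁺ ∣ A ∣ M B g∣B | +∣i∣≡i⊎+∣i∣≡-i A
  ... | t , M∣|A|t-B | inj₁ |A|≡A  = t , subst (λ Â → + M ∣ Â * t - B) |A|≡A M∣|A|t-B
  ... | t , M∣|A|t-B | inj₂ |A|≡-A = - t , subst (λ z → + M ∣ z - B) |A|t≡A[-t] M∣|A|t-B
    where
    |A|t≡A[-t] : + ∣ A ∣ * t ≡ A * - t
    |A|t≡A[-t] = trans (cong (_* t) |A|≡-A) (trans (sym (neg-distribˡ-* A t)) (neg-distribʳ-* A t))

module ChineseRemainder where
  open import Data.Nat.Base as ℕ using (ℕ; zero; suc; _^_; _<_; NonZero)
  open import Data.Nat.Properties using (n<1+n; m<n⇒m<1+n; m<1+n⇒m<n∨m≡n; <-irrefl; m*n≢0; m^n≢0)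
  open import Data.Nat.Divisibility using (_∣_; ∣-trans; 1∣_; ∣1⇒≡1; m∣m*n; n∣m*n)
  open import Data.Nat.Primality using (Prime; prime?; euclidsLemma; ¬prime[1]; prime⇒nonZero)
  open import Data.Nat.Coprimality using (coprime⇒gcd≡1) renaming (sym to coprime-sym)
  open import Data.Integer.Base using (ℤ; +_; 0ℤ; _+_; _-_; _*_)
  open import Data.Integer.Tactic.RingSolver using (solve-∀)
  open import Data.Product using (∃; ∃₂; _×_; _,_; proj₁; proj₂)
  open import Data.Sum using (inj₁; inj₂)
  open import Data.Empty using (⊥-elim)
  open import Relation.Nullary using (¬_; yes; no)
  open import Relation.Binary.PropositionalEquality
  open Multiplicity
  open IntegerValuation
  open LinearCongruence

  module _ (S : ℕ) (P : ℕ → ℤ → Set)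
           (P-solvable : ∀ {π} → Prime π → ∃ (P π))
           (P-stable : ∀ {π} → Prime π → ∀ {x y} → P π x → v[ π ] y - x ≥ S → P π y) where

    private
      Invariant : ℕ → ℤ → ℕ → Set
      Invariant N x M = NonZero M × (∀ {σ} → Prime σ → σ ∣ M → σ < N)
                      × (∀ {π} → Prime π → π < N → P π x × π ^ S ∣ M)

      start : Invariant 0 0ℤ 1
      start = _ , (λ pσ σ∣1 → ⊥-elim (¬prime[1] (subst Prime (∣1⇒≡1 σ∣1) pσ))) , λ _ ()

      skip : ∀ {N x M} → ¬ Prime N → Invariant N x M → Invariant (suc N) x M
      skip {N} {x} {M} ¬pN (M≢0 , M-rough , solves) = M≢0 , (λ pσ σ∣M → m<n⇒m<1+n (M-rough pσ σ∣M)) , solves′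
        where
        solves′ : ∀ {π} → Prime π → π < suc N → P π x × π ^ S ∣ M
        solves′ pπ π<1+N with m<1+n⇒m<n∨m≡n π<1+N
        ... | inj₁ π<N  = solves pπ π<N
        ... | inj₂ refl = ⊥-elim (¬pN pπ)

      extend : ∀ {N x M} → Prime N → Invariant N x M → ∃₂ (Invariant (suc N))
      extend {N} {x} {M} pN (M≢0 , M-rough , solves) = y , M ℕ.* N ^ S , m*n≢0 M (N ^ S) , M′-rough , solves′
        where
        instance
          _ = M≢0
          _ = m^n≢0 N S {{prime⇒nonZero pN}}
        t = proj₁ (P-solvable pN)
        gcd[M,N^S]≡1 = coprime⇒gcd≡1 (coprime-sym (¬∣⇒coprime-^ pN (λ N∣M → <-irrefl refl (M-rough pN N∣M)) S))
        N^S∣Ms-[t-x] = solvable (+ M) (N ^ S) (t - x) (subst (_∣ _) (sym gcd[M,N^S]≡1) (1∣ _))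
        s = proj₁ N^S∣Ms-[t-x]
        y = x + + M * s
        shift : ∀ a b → a + b - a ≡ b
        shift = solve-∀
        regroup : ∀ a t x → a - (t - x) ≡ x + a - t
        regroup = solve-∀
        y≡t : v[ N ] y - t ≥ S
        y≡t = subst (λ z → v[ N ] z ≥ S) (regroup (+ M * s) t x) (fromSigned (proj₂ N^S∣Ms-[t-x]))
        M′-rough : ∀ {σ} → Prime σ → σ ∣ M ℕ.* N ^ S → σ < suc N
        M′-rough pσ σ∣M′ with euclidsLemma M (N ^ S) pσ σ∣M′
        ... | inj₁ σ∣M   = m<n⇒m<1+n (M-rough pσ σ∣M)
        ... | inj₂ σ∣N^S rewrite prime∣^⇒≡ pσ pN S σ∣N^S = n<1+n N
        solves′ : ∀ {π} → Prime π → π < suc N → P π y × π ^ S ∣ M ℕ.* N ^ S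
        solves′ pπ π<1+N with m<1+n⇒m<n∨m≡n π<1+N
        ... | inj₁ π<N = P-stable pπ (proj₁ (solves pπ π<N)) y≡x , ∣-trans π^S∣M (m∣m*n (N ^ S))
          where
          π^S∣M = proj₂ (solves pπ π<N)
          y≡x = subst (λ z → v[ _ ] z ≥ S) (sym (shift x (+ M * s))) (≥-*ʳ {X = + M} s (from-∣ π^S∣M))
        ... | inj₂ refl = P-stable pN (proj₂ (P-solvable pN)) y≡t , n∣m*n M

      invariant : ∀ N → ∃₂ (Invariant N)
      invariant zero = 0ℤ , 1 , start
      invariant (suc N) with invariant N | prime? N
      ... | x , M , inv | no ¬pN = x , M , skip ¬pN inv
      ... | _ , _ , inv | yes pN = extend pN inv

    simultaneous-solution : ∀ N → ∃ λ x → ∀ {π} → Prime π → π < N → P π x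
    simultaneous-solution N with invariant N
    ... | x , _ , _ , _ , solves = x , λ pπ π<N → proj₁ (solves pπ π<N)

module FiniteSums where
  open import Data.Nat.Base using (zero; suc)
  open import Data.Fin.Base using (Fin; zero; suc)
  open import Data.Fin.Permutation using (Permutation′; _⟨$⟩ʳ_)
  open import Data.Integer.Base using (ℤ; +_; 0ℤ; _+_; _-_; _*_)
  import Data.Integer.Properties as ℤ
  open import Data.Integer.Divisibility.Signed using (_∣_; divides; ∣m∣n⇒∣m+n)
  open import Data.Integer.Tactic.RingSolver using (solve-∀)
  open import Relation.Binary.PropositionalEquality
  open import Algebra.Properties.CommutativeMonoid.Sum ℤ.+-0-commutativeMonoid using (sum; sum-permute)
  open import Defs using (ΣFin)

  private
    ΣFin≡sum : ∀ {n} (f : Fin n → ℤ) → ΣFin f ≡ sum f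
    ΣFin≡sum {zero}  f = refl
    ΣFin≡sum {suc n} f = cong (_+_ (f zero)) (ΣFin≡sum (λ i → f (suc i)))

  ΣFin-permute : ∀ {n} (f : Fin n → ℤ) (σ : Permutation′ n) → ΣFin (λ i → f (σ ⟨$⟩ʳ i)) ≡ ΣFin f
  ΣFin-permute f σ = trans (ΣFin≡sum (λ i → f (σ ⟨$⟩ʳ i))) (trans (sym (sum-permute f σ)) (sym (ΣFin≡sum f)))

  ΣFin-+ : ∀ {n} (f g : Fin n → ℤ) → ΣFin (λ i → f i + g i) ≡ ΣFin f + ΣFin g
  ΣFin-+ {zero}  f g = refl
  ΣFin-+ {suc n} f g =
    trans (cong (_+_ (f zero + g zero)) (ΣFin-+ (λ i → f (suc i)) (λ i → g (suc i))))
          (interchange (f zero) (g zero) (ΣFin (λ i → f (suc i))) (ΣFin (λ i → g (suc i))))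
    where
    interchange : ∀ a b c d → a + b + (c + d) ≡ a + c + (b + d)
    interchange = solve-∀

  ΣFin-const : ∀ {n} c → ΣFin {n} (λ _ → c) ≡ + n * c
  ΣFin-const {zero}  c = sym (ℤ.*-zeroˡ c)
  ΣFin-const {suc n} c = trans (cong (_+_ c) (ΣFin-const {n} c)) (factor c (+ n))
    where
    factor : ∀ c m → c + m * c ≡ (+ 1 + m) * c
    factor = solve-∀

  ΣFin-+-const : ∀ {n} (f : Fin n → ℤ) c → ΣFin (λ i → f i + c) ≡ ΣFin f + + n * c
  ΣFin-+-const {n} f c = trans (ΣFin-+ f (λ _ → c)) (cong (_+_ (ΣFin f)) (ΣFin-const {n} c))

  ΣFin-cong-∣ : ∀ {n} M (f g : Fin n → ℤ) → (∀ i → M ∣ f i - g i) → M ∣ ΣFin f - ΣFin g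
  ΣFin-cong-∣ {zero}  M f g _ = divides 0ℤ (sym (ℤ.*-zeroˡ M))
  ΣFin-cong-∣ {suc n} M f g M∣f-g =
    subst (M ∣_) (interchange (f zero) (g zero) (ΣFin (λ i → f (suc i))) (ΣFin (λ i → g (suc i))))
      (∣m∣n⇒∣m+n (M∣f-g zero) (ΣFin-cong-∣ M (λ i → f (suc i)) (λ i → g (suc i)) (λ i → M∣f-g (suc i))))
    where
    interchange : ∀ a b c d → a - b + (c - d) ≡ a + c - (b + d)
    interchange = solve-∀

module GroupElements where
  open import Data.Fin.Permutation using (_⟨$⟩ʳ_)
  open import Data.Integer.Base using (+_; 0ℤ; _+_; _-_; _*_)
  open import Data.Integer.Properties using (+-inverseʳ)
  open import Data.Integer.Divisibility.Signed using (_∣_; divides; ∣ᵤ⇒∣; ∣⇒∣ᵤ)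
  open import Data.Product using (_,_)
  open import Relation.Binary.PropositionalEquality
  open import Defs
  open FiniteSums

  Δ-· : ∀ {n} (g h : GElt n) → Δ (g · h) ≡ Δ g + Δ h
  Δ-· ⟪ π , a ⟫ ⟪ σ , b ⟫ = trans (ΣFin-+ (λ i → a (σ ⟨$⟩ʳ i)) b) (cong (_+ ΣFin b) (ΣFin-permute a σ))

  Δ-·cpow : ∀ {n} (g : GElt n) c → Δ (g · cpow c) ≡ Δ g + + n * c
  Δ-·cpow g c = ΣFin-+-const (vec g) c

  ≡[mod]⇒∣ : ∀ a b {m} → a ≡ b [mod m ] → + m ∣ a - b
  ≡[mod]⇒∣ a b = ∣ᵤ⇒∣ {+ _} {a - b}

  ∣⇒≡[mod] : ∀ a b {m} → + m ∣ a - b → a ≡ b [mod m ]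
  ∣⇒≡[mod] a b = ∣⇒∣ᵤ {+ _} {a - b}

  ≡⇒≡[mod] : ∀ {a b} m → a ≡ b → a ≡ b [mod m ]
  ≡⇒≡[mod] {a} m refl = ∣⇒≡[mod] a a (divides 0ℤ (+-inverseʳ a))

  Δ-cong : ∀ {n} r (g h : GElt n) → g ≈[ r ] h → + r ∣ Δ g - Δ h
  Δ-cong r g h (_ , vec≡) = ΣFin-cong-∣ (+ r) (vec g) (vec h) (λ i → ≡[mod]⇒∣ (vec g i) (vec h i) (vec≡ i))

-- By Δφ≡ku, u = p + n x plays for the image of φ the role that p plays for G(r,p,n); Conditions collects
-- the congruences on p, u, r/q and r/q' that the statements about φ need.
module TwistedMap (r n p p' q q' : ℕ) .{{_ : NonZero q}} .{{_ : NonZero q'}} (x : ℤ) where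
  open import Data.Integer.Base using (+_; 0ℤ; -_; _+_; _-_; _*_)
  open import Data.Integer.Divisibility.Signed using (_∣_; ∣m∣n⇒∣m+n; ∣m∣n⇒∣m-n)
  open Data.Integer.Divisibility.Signed._∣_ using (quotient; equality)
  open import Data.Integer.Tactic.RingSolver using (solve-∀)
  open import Data.Fin.Permutation using (_⟨$⟩ʳ_)
  open import Data.Product using (∃; _×_; _,_; proj₁; proj₂)
  open import Relation.Binary.PropositionalEquality
  open import Defs
  open FiniteSums
  open GroupElements

  Q Q' u : ℤ
  Q  = + (r ℕ./ q)
  Q' = + (r ℕ./ q')
  u  = + p + + n * x

  record Conditions : Set where
    field
      p'∣u               : + p' ∣ u
      p'k′∈⟨u⟩           : ∀ k′ → ∃ λ k → + r ∣ k * u - + p' * k′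
      r∣pj⇒Q'∣jx         : ∀ j → + r ∣ + p * j → Q' ∣ j * x
      r∣ju-nmQ'⇒Q∣mQ'-jx : ∀ j m → + r ∣ j * u - + n * m * Q' → Q ∣ m * Q' - j * x
      r∣pj-nmQ⇒Q'∣mQ+jx  : ∀ j m → + r ∣ + p * j - + n * m * Q → Q' ∣ m * Q + j * x

  Δφ≡ku : ∀ (g : GElt n) k → Adm r p g k → + r ∣ k * u - Δ (φ x g k)
  Δφ≡ku g k g~k = subst (+ r ∣_) (trans (expand (+ p) (+ n) x k (Δ g)) (cong (_-_ (k * u)) (sym (Δ-·cpow g (k * x)))))
                        (≡[mod]⇒∣ (+ p * k) (Δ g) g~k)
    where
    expand : ∀ P N X K D → P * K - D ≡ K * (P + N * X) - (D + N * (K * X))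
    expand = solve-∀

  module _ (C : Conditions) where
    open Conditions C

    φ-wellDefined : ∀ (g h : GElt n) k k' → Adm r p g k → Adm r p h k' → g ≈[ r ] h →
                    InG r p' (φ x g k) × (φ x g k ≈[ r /C q' ] φ x h k')
    φ-wellDefined g h k k' g~k h~k' g≈h@(same-perm , same-vec) = φg∈G , m , same-perm , entries
      where
      w = quotient p'∣u
      φg∈G : InG r p' (φ x g k)
      φg∈G = k * w , ∣⇒≡[mod] (+ p' * (k * w)) (Δ (φ x g k))
                       (subst (λ z → + r ∣ z - Δ (φ x g k)) ku≡p'kw (Δφ≡ku g k g~k))
        where
        reassoc : ∀ k w p → k * (w * p) ≡ p * (k * w)
        reassoc = solve-∀
        ku≡p'kw : k * u ≡ + p' * (k * w)
        ku≡p'kw = trans (cong (k *_) (equality p'∣u)) (reassoc k w (+ p'))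
      combine : ∀ P K K' D E → P * K - D - (P * K' - E) + (D - E) ≡ P * (K - K')
      combine = solve-∀
      r∣p[k-k'] : + r ∣ + p * (k - k')
      r∣p[k-k'] = subst (+ r ∣_) (combine (+ p) k k' (Δ g) (Δ h))
        (∣m∣n⇒∣m+n (∣m∣n⇒∣m-n (≡[mod]⇒∣ (+ p * k) (Δ g) g~k) (≡[mod]⇒∣ (+ p * k') (Δ h) h~k'))
                   (Δ-cong r g h g≈h))
      m = quotient (r∣pj⇒Q'∣jx (k - k') r∣p[k-k'])
      rearrange : ∀ G H K K' X → G - H ≡ (G + K * X) - (H + K' * X + (K - K') * X)
      rearrange = solve-∀
      entries : ∀ i → vec g i + k * x ≡ vec h i + k' * x + m * Q' [mod r ]
      entries i = ∣⇒≡[mod] (vec g i + k * x) (vec h i + k' * x + m * Q') (subst (+ r ∣_)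
        (trans (rearrange (vec g i) (vec h i) k k' x)
               (cong (λ z → vec g i + k * x - (vec h i + k' * x + z)) (equality (r∣pj⇒Q'∣jx (k - k') r∣p[k-k']))))
        (≡[mod]⇒∣ (vec g i) (vec h i) (same-vec i)))

    φ-homomorphism : ∀ (g h : GElt n) kg kh kgh → Adm r p g kg → Adm r p h kh → Adm r p (g · h) kgh →
                     φ x (g · h) kgh ≈[ r /C q' ] (φ x g kg · φ x h kh)
    φ-homomorphism g h kg kh kgh g~kg h~kh gh~kgh = m , (λ _ → refl) , λ i → ≡⇒≡[mod] r (entries i)
      where
      combine : ∀ P A B C D E → P * A - (D + E) - (P * B - D) - (P * C - E) ≡ P * (A - B - C)
      combine = solve-∀
      r∣pδ : + r ∣ + p * (kgh - kg - kh)
      r∣pδ = subst (+ r ∣_)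
        (trans (cong (λ z → + p * kgh - z - (+ p * kg - Δ g) - (+ p * kh - Δ h)) (Δ-· g h))
               (combine (+ p) kgh kg kh (Δ g) (Δ h)))
        (∣m∣n⇒∣m-n (∣m∣n⇒∣m-n (≡[mod]⇒∣ (+ p * kgh) (Δ (g · h)) gh~kgh)
                              (≡[mod]⇒∣ (+ p * kg) (Δ g) g~kg))
                   (≡[mod]⇒∣ (+ p * kh) (Δ h) h~kh))
      Q'∣δx = r∣pj⇒Q'∣jx (kgh - kg - kh) r∣pδ
      m = quotient Q'∣δx
      rearrange : ∀ G H A B C X → G + H + A * X ≡ (G + B * X) + (H + C * X) + (A - B - C) * X
      rearrange = solve-∀
      entries : ∀ i → let G = vec g (perm h ⟨$⟩ʳ i) ; H = vec h i in
                G + H + kgh * x ≡ (G + kg * x) + (H + kh * x) + m * Q'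
      entries i = trans (rearrange (vec g (perm h ⟨$⟩ʳ i)) (vec h i) kgh kg kh x)
                        (cong (λ z → (vec g (perm h ⟨$⟩ʳ i) + kg * x) + (vec h i + kh * x) + z) (equality Q'∣δx))

    φ-surjective : ∀ (y : GElt n) → InG r p' y → ∃ λ g → ∃ λ k → Adm r p g k × (φ x g k ≈[ r /C q' ] y)
    φ-surjective y (k′ , y~k′) = g , k , g~k , 0ℤ , (λ _ → refl) , λ i → ≡⇒≡[mod] r (cancel (vec y i) (k * x) Q')
      where
      k = proj₁ (p'k′∈⟨u⟩ k′)
      g = ⟪ perm y , (λ i → vec y i - k * x) ⟫
      expand : ∀ P N X K P' K′ D → K * (P + N * X) - P' * K′ + (P' * K′ - D) ≡ P * K - (D + N * - (K * X))
      expand = solve-∀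
      g~k : Adm r p g k
      g~k = ∣⇒≡[mod] (+ p * k) (Δ g) (subst (+ r ∣_)
        (trans (expand (+ p) (+ n) x k (+ p') k′ (Δ y)) (cong (_-_ (+ p * k)) (sym (ΣFin-+-const (vec y) (- (k * x))))))
        (∣m∣n⇒∣m+n (proj₂ (p'k′∈⟨u⟩ k′)) (≡[mod]⇒∣ (+ p' * k′) (Δ y) y~k′)))
      cancel : ∀ Y Z Q → Y - Z + Z ≡ Y + 0ℤ * Q
      cancel = solve-∀

    φ-kernel⊆C_q : ∀ (g : GElt n) k → Adm r p g k → φ x g k ≈[ r /C q' ] e → InC r q g
    φ-kernel⊆C_q g k g~k (m , same-perm , entries) = quotient Q∣t , same-perm , entries′
      where
      t = m * Q' - k * x
      rearrange : ∀ G K X M Q → (G + K * X) - (0ℤ + M * Q) ≡ G - (M * Q - K * X)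
      rearrange = solve-∀
      g≡t : ∀ i → + r ∣ vec g i - t
      g≡t i = subst (+ r ∣_) (rearrange (vec g i) k x m Q') (≡[mod]⇒∣ (vec g i + k * x) (0ℤ + m * Q') (entries i))
      expand : ∀ P N X K M Q D → P * K - D + (D - N * (M * Q - K * X)) ≡ K * (P + N * X) - N * M * Q
      expand = solve-∀
      r∣ku-nmQ' : + r ∣ k * u - + n * m * Q'
      r∣ku-nmQ' = subst (+ r ∣_)
        (trans (cong (λ z → + p * k - Δ g + (Δ g - z)) (ΣFin-const {n} t)) (expand (+ p) (+ n) x k m Q' (Δ g)))
        (∣m∣n⇒∣m+n (≡[mod]⇒∣ (+ p * k) (Δ g) g~k) (ΣFin-cong-∣ (+ r) (vec g) (λ _ → t) g≡t))
      Q∣t = r∣ju-nmQ'⇒Q∣mQ'-jx k m r∣ku-nmQ'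
      entries′ : ∀ i → vec g i ≡ quotient Q∣t * Q [mod r ]
      entries′ i = ∣⇒≡[mod] (vec g i) (quotient Q∣t * Q) (subst (λ z → + r ∣ vec g i - z) (equality Q∣t) (g≡t i))

    C_q⊆φ-kernel : ∀ (g : GElt n) k → Adm r p g k → InC r q g → φ x g k ≈[ r /C q' ] e
    C_q⊆φ-kernel g k g~k (m , same-perm , entries) = quotient Q'∣mQ+kx , same-perm , entries′
      where
      expand : ∀ P N K M Q D → P * K - D + (D - N * (M * Q)) ≡ P * K - N * M * Q
      expand = solve-∀
      r∣pk-nmQ : + r ∣ + p * k - + n * m * Q
      r∣pk-nmQ = subst (+ r ∣_)
        (trans (cong (λ z → + p * k - Δ g + (Δ g - z)) (ΣFin-const {n} (m * Q))) (expand (+ p) (+ n) k m Q (Δ g)))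
        (∣m∣n⇒∣m+n (≡[mod]⇒∣ (+ p * k) (Δ g) g~k)
                   (ΣFin-cong-∣ (+ r) (vec g) (λ _ → m * Q) (λ i → ≡[mod]⇒∣ (vec g i) (m * Q) (entries i))))
      Q'∣mQ+kx = r∣pj-nmQ⇒Q'∣mQ+jx k m r∣pk-nmQ
      rearrange : ∀ G M Q K X → G - M * Q ≡ G + K * X - (0ℤ + (M * Q + K * X))
      rearrange = solve-∀
      entries′ : ∀ i → vec g i + k * x ≡ 0ℤ + quotient Q'∣mQ+kx * Q' [mod r ]
      entries′ i = ∣⇒≡[mod] (vec g i + k * x) (0ℤ + quotient Q'∣mQ+kx * Q') (subst (+ r ∣_)
        (trans (rearrange (vec g i) m Q k x) (cong (λ z → vec g i + k * x - (0ℤ + z)) (equality Q'∣mQ+kx)))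
        (≡[mod]⇒∣ (vec g i) (m * Q) (entries i)))

    φ-injective : ∀ (g h : GElt n) k k' → Adm r p g k → Adm r p h k' →
                  φ x g k ≈[ r /C q' ] φ x h k' → g ≈[ r /C q ] h
    φ-injective g h k k' g~k h~k' (m , same-perm , entries) = quotient Q∣t , same-perm , entries′
      where
      t = k' * x - k * x + m * Q'
      rearrange : ∀ G H K K' X M Q → (G + K * X) - ((H + K' * X) + M * Q) ≡ G - (H + (K' * X - K * X + M * Q))
      rearrange = solve-∀
      g≡h+t : ∀ i → + r ∣ vec g i - (vec h i + t)
      g≡h+t i = subst (+ r ∣_) (rearrange (vec g i) (vec h i) k k' x m Q')
        (≡[mod]⇒∣ (vec g i + k * x) (vec h i + k' * x + m * Q') (entries i))
      expand : ∀ P N X K K' M Q D E →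
               P * K - D - (P * K' - E) + (D - (E + N * (K' * X - K * X + M * Q))) ≡ (K - K') * (P + N * X) - N * M * Q
      expand = solve-∀
      r∣[k-k']u-nmQ' : + r ∣ (k - k') * u - + n * m * Q'
      r∣[k-k']u-nmQ' = subst (+ r ∣_)
        (trans (cong (λ z → + p * k - Δ g - (+ p * k' - Δ h) + (Δ g - z)) (ΣFin-+-const (vec h) t))
               (expand (+ p) (+ n) x k k' m Q' (Δ g) (Δ h)))
        (∣m∣n⇒∣m+n (∣m∣n⇒∣m-n (≡[mod]⇒∣ (+ p * k) (Δ g) g~k) (≡[mod]⇒∣ (+ p * k') (Δ h) h~k'))
                   (ΣFin-cong-∣ (+ r) (vec g) (λ i → vec h i + t) g≡h+t))
      Q∣t′ = r∣ju-nmQ'⇒Q∣mQ'-jx (k - k') m r∣[k-k']u-nmQ'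
      regroup : ∀ K K' X M Q → K' * X - K * X + M * Q ≡ M * Q - (K - K') * X
      regroup = solve-∀
      Q∣t : Q ∣ t
      Q∣t = subst (Q ∣_) (sym (regroup k k' x m Q')) Q∣t′
      entries′ : ∀ i → vec g i ≡ vec h i + quotient Q∣t * Q [mod r ]
      entries′ i = ∣⇒≡[mod] (vec g i) (vec h i + quotient Q∣t * Q)
        (subst (λ z → + r ∣ vec g i - (vec h i + z)) (equality Q∣t) (g≡h+t i))

module ValuationArithmetic where
  open import Data.Nat.Base using (_+_; _≤_; _<_; _∸_)
  open import Data.Nat.Properties
  open import Data.Nat.Tactic.RingSolver using (solve-∀)
  open import Relation.Binary.PropositionalEquality
  open import Relation.Nullary using (yes; no; contradiction)

  -- a, a', b, b', c, d, w, w', κ stand for the π-adic valuations of p, p', q, q', r, n, r/q, r/q', rn/pq.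

  module Consequences {a a' b b' c w w' : ℕ}
    (a+b≡a'+b' : a + b ≡ a' + b') (w+b≡c : w + b ≡ c) (w'+b'≡c : w' + b' ≡ c) where

    w'+a≡w+a' : w' + a ≡ w + a'
    w'+a≡w+a' = +-cancelʳ-≡ (b + b') (w' + a) (w + a') (begin
      w' + a + (b + b')  ≡⟨ shuffle w' a b b' ⟩
      w' + b' + (a + b)  ≡⟨ cong₂ _+_ (trans w'+b'≡c (sym w+b≡c)) a+b≡a'+b' ⟩
      w + b + (a' + b')  ≡⟨ shuffle w a' b' b ⟨
      w + a' + (b' + b)  ≡⟨ cong (w + a' +_) (+-comm b' b) ⟩
      w + a' + (b + b')  ∎)
      where
      open ≡-Reasoning
      shuffle : ∀ w a b b' → w + a + (b + b') ≡ w + b' + (a + b)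
      shuffle = solve-∀

    d+w'+a≡d+w+a' : ∀ d → d + w' + a ≡ d + w + a'
    d+w'+a≡d+w+a' d = trans (+-assoc d w' a) (trans (cong (d +_) w'+a≡w+a') (sym (+-assoc d w a')))

    a≡a'⇒w≡w' : a ≡ a' → w ≡ w'
    a≡a'⇒w≡w' refl = sym (+-cancelʳ-≡ a w' w w'+a≡w+a')

    a≢a'⇒b≢b' : a ≢ a' → b ≢ b'
    a≢a'⇒b≢b' a≢a' refl = a≢a' (+-cancelʳ-≡ b a a' a+b≡a'+b')

    a<a'⇒b'<b : a < a' → b' < b
    a<a'⇒b'<b a<a' with b' <? b
    ... | yes b'<b = b'<b
    ... | no  b'≮b = contradiction a+b≡a'+b' (<⇒≢ (+-mono-<-≤ a<a' (≮⇒≥ b'≮b)))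

    w≤c : w ≤ c
    w≤c = m+n≤o⇒m≤o w (≤-reflexive w+b≡c)

    w'≤c : w' ≤ c
    w'≤c = m+n≤o⇒m≤o w' (≤-reflexive w'+b'≡c)

    d≤b⇒d+w≤c : ∀ {d} → d ≤ b → d + w ≤ c
    d≤b⇒d+w≤c {d} d≤b =
      ≤-trans (≤-reflexive (+-comm d w)) (≤-trans (+-monoʳ-≤ w d≤b) (≤-reflexive w+b≡c))

    d≤b'⇒d+w'≤c : ∀ {d} → d ≤ b' → d + w' ≤ c
    d≤b'⇒d+w'≤c {d} d≤b' =
      ≤-trans (≤-reflexive (+-comm d w')) (≤-trans (+-monoʳ-≤ w' d≤b') (≤-reflexive w'+b'≡c))

    d≤b⇒d+a+w'≤c+a' : ∀ {d} → d ≤ b → d + a + w' ≤ c + a'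
    d≤b⇒d+a+w'≤c+a' {d} d≤b = begin
      d + a + w'        ≡⟨ shuffle d a w' ⟩
      w' + (a + d)      ≤⟨ +-monoʳ-≤ w' (+-monoʳ-≤ a d≤b) ⟩
      w' + (a + b)      ≡⟨ cong (w' +_) a+b≡a'+b' ⟩
      w' + (a' + b')    ≡⟨ shuffle′ w' a' b' ⟩
      w' + b' + a'      ≡⟨ cong (_+ a') w'+b'≡c ⟩
      c + a'            ∎
      where
      open ≤-Reasoning
      shuffle : ∀ d a w → d + a + w ≡ w + (a + d)
      shuffle = solve-∀
      shuffle′ : ∀ w a b → w + (a + b) ≡ w + b + a
      shuffle′ = solve-∀

    d≤b'⇒d+a+w'≤c+a : ∀ {d} → d ≤ b' → d + a + w' ≤ c + a
    d≤b'⇒d+a+w'≤c+a {d} d≤b' = begin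
      d + a + w'   ≡⟨ shuffle d a w' ⟩
      d + w' + a   ≤⟨ +-monoˡ-≤ a (d≤b'⇒d+w'≤c d≤b') ⟩
      c + a        ∎
      where
      open ≤-Reasoning
      shuffle : ∀ d a w → d + a + w ≡ d + w + a
      shuffle = solve-∀

    w'+[b+a]≡a'+c : w' + (b + a) ≡ a' + c
    w'+[b+a]≡a'+c = begin
      w' + (b + a)    ≡⟨ cong (w' +_) (trans (+-comm b a) a+b≡a'+b') ⟩
      w' + (a' + b')  ≡⟨ shuffle w' a' b' ⟩
      a' + (w' + b')  ≡⟨ cong (a' +_) w'+b'≡c ⟩
      a' + c          ∎
      where
      open ≡-Reasoning
      shuffle : ∀ w a b → w + (a + b) ≡ a + (w + b)
      shuffle = solve-∀

    c∸b'≡w' : c ∸ b' ≡ w'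
    c∸b'≡w' = trans (cong (_∸ b') (sym w'+b'≡c)) (m+n∸n≡m w' b')

    b'≤b⇒w≤w' : b' ≤ b → w ≤ w'
    b'≤b⇒w≤w' b'≤b =
      +-cancelʳ-≤ b' w w' (≤-trans (+-monoʳ-≤ w b'≤b) (≤-reflexive (trans w+b≡c (sym w'+b'≡c))))

  κ≤w : ∀ {a b c d w κ} → κ + (a + b) ≡ c + d → w + b ≡ c → d ≤ a → κ ≤ w
  κ≤w {a} {b} {c} {d} {w} {κ} κ+a+b≡c+d w+b≡c d≤a = +-cancelʳ-≤ (a + b) κ w (begin
    κ + (a + b)  ≡⟨ κ+a+b≡c+d ⟩
    c + d        ≡⟨ cong (_+ d) w+b≡c ⟨
    w + b + d    ≤⟨ +-monoʳ-≤ (w + b) d≤a ⟩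
    w + b + a    ≡⟨ shuffle w b a ⟩
    w + (a + b)  ∎)
    where
    open ≤-Reasoning
    shuffle : ∀ w b a → w + b + a ≡ w + (a + b)
    shuffle = solve-∀

module LocalAnalysis (r n p p' q q' : ℕ)
    .{{_ : NonZero r}} .{{_ : NonZero n}}
    .{{_ : NonZero p}} .{{_ : NonZero p'}} .{{_ : NonZero q}} .{{_ : NonZero q'}}
    (p∣r : p ℕ.∣ r) (p'∣r : p' ℕ.∣ r) (q∣r : q ℕ.∣ r) (q'∣r : q' ℕ.∣ r)
    (pq≡p'q' : p ℕ.* q ≡ p' ℕ.* q') (pq∣rn : p ℕ.* q ℕ.∣ r ℕ.* n)
    (gcd[p,n]≡gcd[p',n] : gcd p n ≡ gcd p' n) (gcd[q,n]≡gcd[q',n] : gcd q n ≡ gcd q' n) where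
  open import Data.Nat.Base using (zero; suc; _^_; _≤_; _<_; _∸_; ≢-nonZero; ≢-nonZero⁻¹)
  import Data.Nat.Properties as ℕ
  open import Data.Nat.Divisibility using (_∣_; ∣-trans; 1∣_; m∣m*n; ∣⇒≤; m/n∣m)
  open import Data.Nat.DivMod using (m/n*n≡m)
  open import Data.Nat.GCD using (gcd; gcd[m,n]∣m; gcd[m,n]∣n; gcd[m,n]≢0)
  open import Data.Nat.Primality using (Prime)
  open import Data.Nat.Properties using (m*n≢0)
  open import Data.Integer.Base using (+_; 0ℤ; -_; ∣_∣; _+_; _-_; _*_)
  open import Data.Integer.Properties using (pos-*; abs-*; +-identityʳ; +-comm; *-comm)
  open import Relation.Binary.Definitions using (tri<; tri≈; tri>)
  import Data.Integer.Divisibility.Signed as Signed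
  open import Data.Integer.Tactic.RingSolver using (solve-∀)
  open import Data.Product using (∃; _×_; _,_; proj₁; proj₂)
  open import Data.Sum using (inj₂)
  open import Data.Empty using (⊥-elim)
  open import Function using (_∘_)
  open import Relation.Binary.PropositionalEquality
  open import Relation.Nullary using (yes; no)
  open import Defs using (IsMultiplicity; XCond; _≡_[mod_])
  open Multiplicity
  open IntegerValuation
  open LinearCongruence
  open ChineseRemainder
  open GroupElements using (≡⇒≡[mod]; ∣⇒≡[mod])
  open ValuationArithmetic

  r/q r/q' rn/pq : ℕ
  r/q   = r ℕ./ q
  r/q'  = r ℕ./ q'
  rn/pq = (r ℕ.* n) ℕ./ (p ℕ.* q) where instance _ = m*n≢0 p q

  private
    factor-nonZero : ∀ A B {C} → .{{NonZero C}} → A ℕ.* B ≡ C → NonZero A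
    factor-nonZero A B {C} A*B≡C = ≢-nonZero λ A≡0 → ≢-nonZero⁻¹ C (trans (sym A*B≡C) (cong (ℕ._* B) A≡0))

    instance
      pq≢0   = m*n≢0 p q
      p'q'≢0 = m*n≢0 p' q'
      rn≢0   = m*n≢0 r n

    r/q*q≡r : r/q ℕ.* q ≡ r
    r/q*q≡r = m/n*n≡m q∣r

    r/q'*q'≡r : r/q' ℕ.* q' ≡ r
    r/q'*q'≡r = m/n*n≡m q'∣r

    rn/pq*pq≡rn : rn/pq ℕ.* (p ℕ.* q) ≡ r ℕ.* n
    rn/pq*pq≡rn = m/n*n≡m pq∣rn

    instance
      r/q≢0   = factor-nonZero r/q q r/q*q≡r
      r/q'≢0  = factor-nonZero r/q' q' r/q'*q'≡r
      rn/pq≢0 = factor-nonZero rn/pq (p ℕ.* q) rn/pq*pq≡rn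

  module AtPrime {π} (pπ : Prime π) where
    opaque
      v : ∀ X → .{{NonZero X}} → ℕ
      v X = proj₁ (multiplicity-exists pπ X)

      v-spec : ∀ X → .{{_ : NonZero X}} → IsMultiplicity π X (v X)
      v-spec X = proj₂ (multiplicity-exists pπ X)

    v-* : ∀ {X Y Z} → .{{_ : NonZero X}} → .{{_ : NonZero Y}} → .{{_ : NonZero Z}} →
          X ℕ.* Y ≡ Z → v X ℕ.+ v Y ≡ v Z
    v-* {X} {Y} refl = multiplicity-unique {π} (multiplicity-* {e = v X} {f = v Y} pπ (v-spec X) (v-spec Y)) (v-spec (X ℕ.* Y))
      where instance _ = m*n≢0 X Y

    a a' b b' c d w w' κ : ℕ
    a  = v p
    a' = v p'
    b  = v q
    b' = v q'
    c  = v r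
    d  = v n
    w  = v r/q
    w' = v r/q'
    κ  = v rn/pq

    v-≥ : ∀ X → .{{_ : NonZero X}} → v[ π ] + X ≥ v X
    v-≥ X = from-∣ (proj₁ (v-spec X))

    a+b≡a'+b' : a ℕ.+ b ≡ a' ℕ.+ b'
    a+b≡a'+b' = trans (v-* pq≡p'q') (sym (v-* refl))

    w+b≡c : w ℕ.+ b ≡ c
    w+b≡c = v-* r/q*q≡r

    w'+b'≡c : w' ℕ.+ b' ≡ c
    w'+b'≡c = v-* r/q'*q'≡r

    κ+[a+b]≡c+d : κ ℕ.+ (a ℕ.+ b) ≡ c ℕ.+ d
    κ+[a+b]≡c+d = trans (cong (κ ℕ.+_) (v-* refl)) (trans (v-* rn/pq*pq≡rn) (sym (v-* refl)))

    open Consequences {a} {a'} {b} {b'} {c} {w} {w'} a+b≡a'+b' w+b≡c w'+b'≡c public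

    a≢a'⇒d≤b : a ≢ a' → d ≤ b
    a≢a'⇒d≤b a≢a' = gcd≡⇒multiplicity≤ (v-spec q) (v-spec q') (v-spec n) gcd[q,n]≡gcd[q',n] (a≢a'⇒b≢b' a≢a')

    a≢a'⇒d≤b' : a ≢ a' → d ≤ b'
    a≢a'⇒d≤b' a≢a' = gcd≡⇒multiplicity≤ (v-spec q') (v-spec q) (v-spec n) (sym gcd[q,n]≡gcd[q',n])
                        (a≢a'⇒b≢b' a≢a' ∘ sym)

    a<a'⇒d≤a : a < a' → d ≤ a
    a<a'⇒d≤a a<a' = gcd≡⇒multiplicity≤ (v-spec p) (v-spec p') (v-spec n) gcd[p,n]≡gcd[p',n] (ℕ.<⇒≢ a<a')

    a'<a⇒d≤a' : a' < a → d ≤ a'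
    a'<a⇒d≤a' a'<a = gcd≡⇒multiplicity≤ (v-spec p') (v-spec p) (v-spec n) (sym gcd[p,n]≡gcd[p',n]) (ℕ.<⇒≢ a'<a)

  ∣-locally : ∀ A {B} → .{{NonZero A}} → A ∣ r →
              (∀ {σ} (pσ : Prime σ) → σ ∣ r ℕ.* n → ∀ e → σ ^ e ∣ A → σ ^ e ∣ B) → A ∣ B
  ∣-locally A {B} A∣r local = prime-powers∣⇒∣ A local′
    where
    local′ : ∀ σ e → Prime σ → σ ^ e ∣ A → σ ^ e ∣ B
    local′ σ zero    _  _       = 1∣ B
    local′ σ (suc e) pσ σ^1+e∣A =
      local pσ (∣-trans (m∣m*n (σ ^ e)) (∣-trans σ^1+e∣A (∣-trans A∣r (m∣m*n n)))) (suc e) σ^1+e∣A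

  ∣-locallyℤ : ∀ A → .{{_ : NonZero A}} → A ∣ r → ∀ Z →
               (∀ {σ} (pσ : Prime σ) → σ ∣ r ℕ.* n → v[ σ ] Z ≥ AtPrime.v pσ A) → + A Signed.∣ Z
  ∣-locallyℤ A A∣r Z local = Signed.∣ᵤ⇒∣ {+ A} {Z} (∣-locally A A∣r λ {σ} pσ σ∣rn e σ^e∣A →
    to-∣ (≥-weaken {f = e} (multiplicity-maximal {σ} (AtPrime.v-spec pσ A) σ^e∣A) (local pσ σ∣rn)))

  module _ (x : ℤ) (x-spec : XCond r n p p' q q' x) where
    open TwistedMap r n p p' q q' x using (u; Conditions)

    [Kx+Q]qp≡ur : (+ rn/pq * x + + r/q) * + (q ℕ.* p) ≡ u * + r
    [Kx+Q]qp≡ur = begin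
      (K * x + Q) * + (q ℕ.* p)            ≡⟨ cong (λ z → (K * x + Q) * z) (pos-* q p) ⟩
      (K * x + Q) * (+ q * + p)            ≡⟨ expand K x Q (+ q) (+ p) ⟩
      K * (+ p * + q) * x + Q * + q * + p  ≡⟨ cong₂ (λ A B → A * x + B * + p) K[pq]≡rn Qq≡r ⟩
      + r * + n * x + + r * + p            ≡⟨ factor (+ r) (+ n) x (+ p) ⟩
      u * + r                              ∎
      where
      open ≡-Reasoning
      K = + rn/pq
      Q = + r/q
      K[pq]≡rn : K * (+ p * + q) ≡ + r * + n
      K[pq]≡rn = trans (cong (λ z → K * z) (sym (pos-* p q)))
                   (trans (sym (pos-* rn/pq (p ℕ.* q))) (trans (cong +_ rn/pq*pq≡rn) (pos-* r n)))
      Qq≡r : Q * + q ≡ + r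
      Qq≡r = trans (sym (pos-* r/q q)) (cong +_ r/q*q≡r)
      expand : ∀ K x Q q p → (K * x + Q) * (q * p) ≡ K * (p * q) * x + Q * q * p
      expand = solve-∀
      factor : ∀ r n x p → r * n * x + r * p ≡ (p + n * x) * r
      factor = solve-∀

    module Local {π} (pπ : Prime π) (π∣rn : π ∣ r ℕ.* n) where
      open AtPrime pπ public

      private
        x-conditions = x-spec π pπ π∣rn a a' b' c d (v-spec p) (v-spec p') (v-spec q') (v-spec r) (v-spec n)

      r∣⇒≥c : ∀ {Z} → + r Signed.∣ Z → v[ π ] Z ≥ c
      r∣⇒≥c {Z} r∣Z = from-∣ (∣-trans (proj₁ (v-spec r)) (Signed.∣⇒∣ᵤ {+ r} {Z} r∣Z))

      a≡a'⇒x-≥ : a ≡ a' → v[ π ] x ≥ suc a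
      a≡a'⇒x-≥ a≡a' =
        subst (λ z → v[ π ] z ≥ suc a) (+-identityʳ x) (≡[mod]⇒≥ {X = x} {Y = 0ℤ} (proj₁ x-conditions a≡a'))

      -- The congruences imposed on x are chosen so that v_π(u) = v_π(p').
      u-exact : IsMultiplicity π ∣ u ∣ a'
      u-exact with ℕ.<-cmp a a'
      ... | tri≈ _ a≡a' _ =
        subst (IsMultiplicity π ∣ u ∣) a≡a'
          (multiplicity-+ {X = + p} {e = a} {Y = + n * x} (v-spec p) (≥-*ˡ (+ n) (a≡a'⇒x-≥ a≡a')))
      ... | tri> _ _ a'<a =
        subst (λ z → IsMultiplicity π ∣ z ∣ a') (+-comm (+ n * x) (+ p))
          (multiplicity-+ {X = + n * x} {e = a'} {Y = + p} nx-exact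
                          (from-∣ (∣-trans (^-monoʳ-∣ π a'<a) (proj₁ (v-spec p)))))
        where
        x-exact : IsMultiplicity π ∣ x ∣ (a' ∸ d)
        x-exact = ≡π^e⇒multiplicity {X = x} {e = a' ∸ d} pπ (proj₁ (proj₂ x-conditions) a'<a)
        nx-exact : IsMultiplicity π ∣ + n * x ∣ a'
        nx-exact = subst (IsMultiplicity π ∣ + n * x ∣) (ℕ.m+[n∸m]≡n (a'<a⇒d≤a' a'<a))
                     (multiplicityℤ-* {X = + n} {e = d} {Y = x} {f = a' ∸ d} pπ (v-spec n) x-exact)
      ... | tri< a<a' _ _ = multiplicityℤ-*-cancelʳ {X = u} {Y = + r} {e = a'} {f = c} pπ u*r-exact (v-spec r)
        where
        Kx+Q-exact : IsMultiplicity π ∣ + rn/pq * x + + r/q ∣ w'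
        Kx+Q-exact = subst (IsMultiplicity π ∣ + rn/pq * x + + r/q ∣) c∸b'≡w'
                       (≡π^e⇒multiplicity {X = + rn/pq * x + + r/q} {e = c ∸ b'} pπ (proj₂ (proj₂ x-conditions) a<a'))
        u*r-exact : IsMultiplicity π ∣ u * + r ∣ (a' ℕ.+ c)
        u*r-exact = subst₂ (λ Z k → IsMultiplicity π ∣ Z ∣ k) [Kx+Q]qp≡ur w'+[b+a]≡a'+c
                      (multiplicityℤ-* {X = + rn/pq * x + + r/q} {e = w'} {Y = + (q ℕ.* p)} {f = b ℕ.+ a} pπ Kx+Q-exact
                        (multiplicity-* {e = b} {f = a} pπ (v-spec q) (v-spec p)))

      u-≥ : v[ π ] u ≥ a'
      u-≥ = multiplicity⇒≥ u-exact

      pj-≥c⇒jx-≥w' : ∀ j → v[ π ] + p * j ≥ c → v[ π ] j * x ≥ w'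
      pj-≥c⇒jx-≥w' j vpj with a ℕ.≟ a'
      ... | yes a≡a' = ≥-cancelʳ {Y = + p} {f = a} {X = j * x} {e = w'} pπ (v-spec p)
        (subst (λ Z → v[ π ] Z ≥ w' ℕ.+ a) (reorder (+ p) j x)
          (≥-weaken (ℕ.+-mono-≤ w'≤c (ℕ.n≤1+n a)) (≥-* vpj (a≡a'⇒x-≥ a≡a'))))
        where
        reorder : ∀ P J X → P * J * X ≡ J * X * P
        reorder = solve-∀
      ... | no a≢a' = ≥-cancelˡ {Y = + (n ℕ.* p)} {f = d ℕ.+ a} {X = j * x} {e = w'} pπ
        (multiplicity-* {e = d} {f = a} pπ (v-spec n) (v-spec p))
        (subst (λ Z → v[ π ] Z ≥ d ℕ.+ a ℕ.+ w') pju-pjp≡npjx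
          (≥-sub (≥-weaken (d≤b⇒d+a+w'≤c+a' (a≢a'⇒d≤b a≢a')) (≥-* vpj u-≥))
                 (≥-weaken (d≤b'⇒d+a+w'≤c+a (a≢a'⇒d≤b' a≢a')) (≥-* vpj (v-≥ p)))))
        where
        expand : ∀ P N J X → P * J * (P + N * X) - P * J * P ≡ N * P * (J * X)
        expand = solve-∀
        pju-pjp≡npjx : + p * j * u - + p * j * + p ≡ + (n ℕ.* p) * (j * x)
        pju-pjp≡npjx = trans (expand (+ p) (+ n) j x) (cong (_* (j * x)) (sym (pos-* n p)))

      ju-nmQ'-≥c⇒mQ'-jx-≥w : ∀ j m → v[ π ] j * u - + n * m * + r/q' ≥ c → v[ π ] m * + r/q' - j * x ≥ w
      ju-nmQ'-≥c⇒mQ'-jx-≥w j m vh with a ℕ.≟ a'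
      ... | yes a≡a' =
        subst (v[ π ] m * + r/q' - j * x ≥_) (sym (a≡a'⇒w≡w' a≡a')) (≥-sub (≥-*ˡ m (v-≥ r/q')) vjx)
        where
        cancel : ∀ A B → A - B + B ≡ A
        cancel = solve-∀
        reorder : ∀ J U X → J * U * X ≡ J * X * U
        reorder = solve-∀
        vju : v[ π ] j * u ≥ w'
        vju = subst (λ Z → v[ π ] Z ≥ w') (cancel (j * u) (+ n * m * + r/q'))
                (≥-+ (≥-weaken w'≤c vh) (≥-*ˡ (+ n * m) (v-≥ r/q')))
        vjx : v[ π ] j * x ≥ w'
        vjx = ≥-cancelʳ {Y = u} {f = a'} {X = j * x} {e = w'} pπ u-exact
                (subst (λ Z → v[ π ] Z ≥ w' ℕ.+ a') (reorder j u x)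
                  (≥-weaken (ℕ.+-monoʳ-≤ w' (ℕ.≤-trans (ℕ.≤-reflexive (sym a≡a')) (ℕ.n≤1+n a)))
                            (≥-* vju (a≡a'⇒x-≥ a≡a'))))
      ... | no a≢a' = ≥-cancelˡ {Y = + n} {f = d} {X = m * + r/q' - j * x} {e = w} pπ (v-spec n)
        (subst (λ Z → v[ π ] Z ≥ d ℕ.+ w) (rearrange j (+ p) (+ n) x m (+ r/q'))
          (≥-sub vjp (≥-weaken (d≤b⇒d+w≤c (a≢a'⇒d≤b a≢a')) vh)))
        where
        cancel : ∀ A B → A - B + B ≡ A
        cancel = solve-∀
        reorder : ∀ J U P → J * U * P ≡ J * P * U
        reorder = solve-∀
        rearrange : ∀ J P N X M Q → J * P - (J * (P + N * X) - N * M * Q) ≡ N * (M * Q - J * X)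
        rearrange = solve-∀
        vju : v[ π ] j * u ≥ d ℕ.+ w'
        vju = subst (λ Z → v[ π ] Z ≥ d ℕ.+ w') (cancel (j * u) (+ n * m * + r/q'))
                (≥-+ (≥-weaken (d≤b'⇒d+w'≤c (a≢a'⇒d≤b' a≢a')) vh) (≥-* (≥-*ʳ m (v-≥ n)) (v-≥ r/q')))
        vjp : v[ π ] j * + p ≥ d ℕ.+ w
        vjp = ≥-cancelʳ {Y = u} {f = a'} {X = j * + p} {e = d ℕ.+ w} pπ u-exact
                (subst₂ (λ Z k → v[ π ] Z ≥ k) (reorder j u (+ p)) (d+w'+a≡d+w+a' d) (≥-* vju (v-≥ p)))

      pj-nmQ-≥c⇒mQ+jx-≥w' : ∀ j m → v[ π ] + p * j - + n * m * + r/q ≥ c → v[ π ] m * + r/q + j * x ≥ w'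
      pj-nmQ-≥c⇒mQ+jx-≥w' j m vh with a ℕ.≟ a'
      ... | yes a≡a' =
        subst (v[ π ] m * + r/q + j * x ≥_) (a≡a'⇒w≡w' a≡a') (≥-+ (≥-*ˡ m (v-≥ r/q)) vjx)
        where
        cancel : ∀ A B → A - B + B ≡ A
        cancel = solve-∀
        reorder : ∀ P J X → P * J * X ≡ J * X * P
        reorder = solve-∀
        vpj : v[ π ] + p * j ≥ w
        vpj = subst (λ Z → v[ π ] Z ≥ w) (cancel (+ p * j) (+ n * m * + r/q))
                (≥-+ (≥-weaken w≤c vh) (≥-*ˡ (+ n * m) (v-≥ r/q)))
        vjx : v[ π ] j * x ≥ w
        vjx = ≥-cancelʳ {Y = + p} {f = a} {X = j * x} {e = w} pπ (v-spec p)
                (subst (λ Z → v[ π ] Z ≥ w ℕ.+ a) (reorder (+ p) j x)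
                  (≥-weaken (ℕ.+-monoʳ-≤ w (ℕ.n≤1+n a)) (≥-* vpj (a≡a'⇒x-≥ a≡a'))))
      ... | no a≢a' = ≥-cancelˡ {Y = + n} {f = d} {X = m * + r/q + j * x} {e = w'} pπ (v-spec n)
        (subst (λ Z → v[ π ] Z ≥ d ℕ.+ w') (rearrange j (+ p) (+ n) x m (+ r/q))
          (≥-sub vju (≥-weaken (d≤b'⇒d+w'≤c (a≢a'⇒d≤b' a≢a')) vh)))
        where
        cancel : ∀ A B → A - B + B ≡ A
        cancel = solve-∀
        reorder : ∀ P J U → P * J * U ≡ J * U * P
        reorder = solve-∀
        rearrange : ∀ J P N X M Q → J * (P + N * X) - (P * J - N * M * Q) ≡ N * (M * Q + J * X)
        rearrange = solve-∀
        vpj : v[ π ] + p * j ≥ d ℕ.+ w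
        vpj = subst (λ Z → v[ π ] Z ≥ d ℕ.+ w) (cancel (+ p * j) (+ n * m * + r/q))
                (≥-+ (≥-weaken (d≤b⇒d+w≤c (a≢a'⇒d≤b a≢a')) vh) (≥-* (≥-*ʳ m (v-≥ n)) (v-≥ r/q)))
        vju : v[ π ] j * u ≥ d ℕ.+ w'
        vju = ≥-cancelʳ {Y = + p} {f = a} {X = j * u} {e = d ℕ.+ w'} pπ (v-spec p)
                (subst₂ (λ Z k → v[ π ] Z ≥ k) (reorder (+ p) j u) (sym (d+w'+a≡d+w+a' d)) (≥-* vpj u-≥))

    conditions : Conditions
    conditions = record
      { p'∣u               = ∣-locallyℤ p' p'∣r u λ pσ σ∣rn → Local.u-≥ pσ σ∣rn
      ; p'k′∈⟨u⟩           = ku≡p'k′-solvable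
      ; r∣pj⇒Q'∣jx         = λ j r∣pj → ∣-locallyℤ r/q' (m/n∣m q'∣r) (j * x) λ pσ σ∣rn →
                               Local.pj-≥c⇒jx-≥w' pσ σ∣rn j (Local.r∣⇒≥c pσ σ∣rn r∣pj)
      ; r∣ju-nmQ'⇒Q∣mQ'-jx = λ j m r∣ju-nmQ' → ∣-locallyℤ r/q (m/n∣m q∣r) _ λ pσ σ∣rn →
                               Local.ju-nmQ'-≥c⇒mQ'-jx-≥w pσ σ∣rn j m (Local.r∣⇒≥c pσ σ∣rn r∣ju-nmQ')
      ; r∣pj-nmQ⇒Q'∣mQ+jx  = λ j m r∣pj-nmQ → ∣-locallyℤ r/q' (m/n∣m q'∣r) _ λ pσ σ∣rn →
                               Local.pj-nmQ-≥c⇒mQ+jx-≥w' pσ σ∣rn j m (Local.r∣⇒≥c pσ σ∣rn r∣pj-nmQ)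
      }
      where
      instance
        gcd≢0 : NonZero (gcd (∣ u ∣) r)
        gcd≢0 = ≢-nonZero (gcd[m,n]≢0 (∣ u ∣) r (inj₂ (≢-nonZero⁻¹ r)))
      gcd[|u|,r]∣p' : gcd (∣ u ∣) r ∣ p'
      gcd[|u|,r]∣p' = ∣-locally (gcd (∣ u ∣) r) (gcd[m,n]∣n (∣ u ∣) r) λ {σ} pσ σ∣rn e σ^e∣gcd →
        ∣-trans (^-monoʳ-∣ {e} {AtPrime.v pσ p'} σ
                  (multiplicity-maximal {σ} {f = e} (Local.u-exact pσ σ∣rn) (∣-trans σ^e∣gcd (gcd[m,n]∣m (∣ u ∣) r))))
                (proj₁ (AtPrime.v-spec pσ p'))
      ku≡p'k′-solvable : ∀ k′ → ∃ λ k → + r Signed.∣ k * u - + p' * k′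
      ku≡p'k′-solvable k′ = proj₁ solution , subst (λ z → + r Signed.∣ z - + p' * k′) (*-comm u _) (proj₂ solution)
        where
        p'∣|p'k′| = subst (p' ∣_) (sym (abs-* (+ p') k′)) (m∣m*n ∣ k′ ∣)
        solution = solvable u r (+ p' * k′) (∣-trans gcd[|u|,r]∣p' p'∣|p'k′|)

  -- XCond at a single prime.  Imposing it at every prime, not only at those dividing rn, costs nothing
  -- and lets the Chinese remainder argument run over all primes below rn + 1.
  LocalCondition : ℕ → ℤ → Set
  LocalCondition π x = ∀ a a' b' c d →
    IsMultiplicity π p a → IsMultiplicity π p' a' → IsMultiplicity π q' b' →
    IsMultiplicity π r c → IsMultiplicity π n d →
      (a ≡ a' → x ≡ 0ℤ [mod π ^ suc a ])
    × (a' < a → x ≡ + (π ^ (a' ∸ d)) [mod π ^ suc (a' ∸ d) ])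
    × (a < a' → + rn/pq * x + + r/q ≡ + (π ^ (c ∸ b')) [mod π ^ suc (c ∸ b') ])

  module _ {π} (pπ : Prime π) where
    open AtPrime pπ

    LocalCondition-intro : ∀ {x} →
        (a ≡ a' → x ≡ 0ℤ [mod π ^ suc a ])
      × (a' < a → x ≡ + (π ^ (a' ∸ d)) [mod π ^ suc (a' ∸ d) ])
      × (a < a' → + rn/pq * x + + r/q ≡ + (π ^ w') [mod π ^ suc w' ])
      → LocalCondition π x
    LocalCondition-intro {x} (cond₁ , cond₂ , cond₃) a₁ a₁' b₁' c₁ d₁ ma ma' mb' mc md
      with multiplicity-unique {π} {e = a} {f = a₁} (v-spec p) ma
         | multiplicity-unique {π} {e = a'} {f = a₁'} (v-spec p') ma'
         | multiplicity-unique {π} {e = b'} {f = b₁'} (v-spec q') mb'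
         | multiplicity-unique {π} {e = c} {f = c₁} (v-spec r) mc
         | multiplicity-unique {π} {e = d} {f = d₁} (v-spec n) md
    ... | refl | refl | refl | refl | refl =
      cond₁ , cond₂ ,
      λ a<a' → subst (λ E → + rn/pq * x + + r/q ≡ + (π ^ E) [mod π ^ suc E ]) (sym c∸b'≡w') (cond₃ a<a')

    local-solution : ∃ (LocalCondition π)
    local-solution with ℕ.<-cmp a a'
    ... | tri≈ _ a≡a' _ = 0ℤ , LocalCondition-intro
      ( (λ _ → ≡⇒≡[mod] {a = 0ℤ} (π ^ suc a) refl)
      , (λ a'<a → ⊥-elim (ℕ.<-irrefl (sym a≡a') a'<a))
      , (λ a<a' → ⊥-elim (ℕ.<-irrefl a≡a' a<a')) )
    ... | tri> _ _ a'<a = + (π ^ (a' ∸ d)) , LocalCondition-intro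
      ( (λ a≡a' → ⊥-elim (ℕ.<-irrefl (sym a≡a') a'<a))
      , (λ _ → ≡⇒≡[mod] {a = + (π ^ (a' ∸ d))} (π ^ suc (a' ∸ d)) refl)
      , (λ a<a' → ⊥-elim (ℕ.<-asym a<a' a'<a)) )
    ... | tri< a<a' _ _ = proj₁ solution , LocalCondition-intro
      ( (λ a≡a' → ⊥-elim (ℕ.<-irrefl a≡a' a<a'))
      , (λ a'<a → ⊥-elim (ℕ.<-asym a<a' a'<a))
      , (λ _ → Kt+Q≡π^w') )
      where
      κ≤w₀ : κ ≤ w
      κ≤w₀ = κ≤w κ+[a+b]≡c+d w+b≡c (a<a'⇒d≤a a<a')
      κ≤w' : κ ≤ w'
      κ≤w' = ℕ.≤-trans κ≤w₀ (b'≤b⇒w≤w' (ℕ.<⇒≤ (a<a'⇒b'<b a<a')))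
      π^w'-Q-≥κ : v[ π ] + (π ^ w') - + r/q ≥ κ
      π^w'-Q-≥κ = ≥-sub {X = + (π ^ w')} (from-∣ (^-monoʳ-∣ π κ≤w')) (≥-weaken κ≤w₀ (v-≥ r/q))
      gcd∣π^w'-Q : gcd rn/pq (π ^ suc w') ∣ ∣ + (π ^ w') - + r/q ∣
      gcd∣π^w'-Q = ∣-trans (gcd[X,π^m]∣π^e {X = rn/pq} {e = κ} pπ (v-spec rn/pq) (suc w')) (to-∣ π^w'-Q-≥κ)
      solution = solvable (+ rn/pq) (π ^ suc w') (+ (π ^ w') - + r/q) gcd∣π^w'-Q
      regroup : ∀ K t P Q → K * t - (P - Q) ≡ K * t + Q - P
      regroup = solve-∀
      Kt+Q≡π^w' : + rn/pq * proj₁ solution + + r/q ≡ + (π ^ w') [mod π ^ suc w' ]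
      Kt+Q≡π^w' = ∣⇒≡[mod] (+ rn/pq * proj₁ solution + + r/q) (+ (π ^ w'))
        (subst (+ (π ^ suc w') Signed.∣_) (regroup (+ rn/pq) (proj₁ solution) (+ (π ^ w')) (+ r/q)) (proj₂ solution))

  local-stable : ∀ {π} → Prime π → ∀ {x y} → LocalCondition π x → v[ π ] y - x ≥ r → LocalCondition π y
  local-stable {π} pπ {x} {y} x-cond y≡x a a' b' c d ma ma' mb' mc md =
      shift {t = 0ℤ} (ℕ.≤-trans (ℕ.s≤s a≤c) c<r) ∘ proj₁ C
    , shift {t = + (π ^ (a' ∸ d))} (ℕ.≤-trans (ℕ.s≤s (ℕ.≤-trans (ℕ.m∸n≤m a' d) a'≤c)) c<r) ∘ proj₁ (proj₂ C)
    , shiftK {t = + (π ^ (c ∸ b'))} (ℕ.≤-trans (ℕ.s≤s (ℕ.m∸n≤m c b')) c<r) ∘ proj₂ (proj₂ C)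
    where
    C = x-cond a a' b' c d ma ma' mb' mc md
    c<r : c < r
    c<r = multiplicity-< pπ mc
    a≤c : a ≤ c
    a≤c = multiplicity-maximal {π} mc (∣-trans (proj₁ ma) p∣r)
    a'≤c : a' ≤ c
    a'≤c = multiplicity-maximal {π} mc (∣-trans (proj₁ ma') p'∣r)
    regroup : ∀ x y t → x - t + (y - x) ≡ y - t
    regroup = solve-∀
    shift : ∀ {E t} → suc E ≤ r → x ≡ t [mod π ^ suc E ] → y ≡ t [mod π ^ suc E ]
    shift {E} {t} 1+E≤r x≡t = to-∣ (subst (λ Z → v[ π ] Z ≥ suc E) (regroup x y t)
      (≥-+ (≡[mod]⇒≥ {X = x} {Y = t} x≡t) (≥-weaken 1+E≤r y≡x)))
    regroupK : ∀ K Q x y t → K * x + Q - t + K * (y - x) ≡ K * y + Q - t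
    regroupK = solve-∀
    shiftK : ∀ {E t} → suc E ≤ r →
             + rn/pq * x + + r/q ≡ t [mod π ^ suc E ] → + rn/pq * y + + r/q ≡ t [mod π ^ suc E ]
    shiftK {E} {t} 1+E≤r Kx+Q≡t = to-∣ (subst (λ Z → v[ π ] Z ≥ suc E) (regroupK (+ rn/pq) (+ r/q) x y t)
      (≥-+ (≡[mod]⇒≥ {X = + rn/pq * x + + r/q} {Y = t} Kx+Q≡t) (≥-*ˡ (+ rn/pq) (≥-weaken 1+E≤r y≡x))))

  x-exists : ∃ (XCond r n p p' q q')
  x-exists with simultaneous-solution r LocalCondition local-solution local-stable (suc (r ℕ.* n))
  ... | x , solves = x , λ π pπ π∣rn → solves pπ (ℕ.s≤s (∣⇒≤ π∣rn))

open import Defs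
open import Data.Nat using (ℕ; NonZero; _*_)
open import Data.Nat.Divisibility using (_∣_)
open import Data.Nat.GCD using (gcd)
open import Data.Product using (∃; _×_; _,_)
open import Relation.Binary.PropositionalEquality using (_≡_)

theorem5p3 : (r n p p' q q' : ℕ)
    .{{_ : NonZero r}} .{{_ : NonZero n}}
    .{{_ : NonZero p}} .{{_ : NonZero p'}} .{{_ : NonZero q}} .{{_ : NonZero q'}} →
    p ∣ r → p' ∣ r → q ∣ r → q' ∣ r →
    p * q ≡ p' * q' → (p * q) ∣ (r * n) →
    gcd p n ≡ gcd p' n → gcd q n ≡ gcd q' n →
    (∃ λ x → XCond r n p p' q q' x)
    × (∀ x → XCond r n p p' q q' x →
        (∀ (g h : GElt n) k k' → Adm r p g k → Adm r p h k' → g ≈[ r ] h →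
           InG r p' (φ x g k) × (φ x g k ≈[ r /C q' ] φ x h k'))
      × (∀ (g h : GElt n) kg kh kgh →
           Adm r p g kg → Adm r p h kh → Adm r p (g · h) kgh →
           φ x (g · h) kgh ≈[ r /C q' ] (φ x g kg · φ x h kh))
      × (∀ (y : GElt n) → InG r p' y →
           ∃ λ g → ∃ λ k → Adm r p g k × (φ x g k ≈[ r /C q' ] y))
      × (∀ (g : GElt n) k → Adm r p g k →
           ((φ x g k ≈[ r /C q' ] e) → InC r q g) × (InC r q g → φ x g k ≈[ r /C q' ] e))
      × (∀ (g h : GElt n) k k' → Adm r p g k → Adm r p h k' →
           (φ x g k ≈[ r /C q' ] φ x h k') → g ≈[ r /C q ] h))
theorem5p3 r n p p' q q' p∣r p'∣r q∣r q'∣r pq≡p'q' pq∣rn gcd[p,n]≡gcd[p',n] gcd[q,n]≡gcd[q',n] =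
  x-exists , λ x x-spec → let open TwistedMap r n p p' q q' x; C = conditions x x-spec in
      φ-wellDefined C
    , φ-homomorphism C
    , φ-surjective C
    , (λ g k g~k → φ-kernel⊆C_q C g k g~k , C_q⊆φ-kernel C g k g~k)
    , φ-injective C
  where
  open LocalAnalysis r n p p' q q' p∣r p'∣r q∣r q'∣r pq≡p'q' pq∣rn gcd[p,n]≡gcd[p',n] gcd[q,n]≡gcd[q',n]
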